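{- Let $l_1\ge0$, $l_2\ge0$, $l_3\ge3$ be integers with $7l_3\ge4(l_1+l_2)+17$ and $l_1(l_3-1)+l_2>3$. Let $\sigma$ be the substitution on $\{0,1\}$ given by $1\mapsto 1\,0^{l_1}\,1\,0^{l_2}$, $0\mapsto 0^{l_3}$, let $\mathbf{c}=\sigma^\infty(1)$ be its fixed point beginning with $1$ (the Cantor-like sequence), and let $S=\theta(\mathbf{c})=\{S_0<S_1<\cdots\}$ be the corresponding sum-free set. Then the sequence $(S_n)_{n\ge0}$ is $2$-regular.
   Context: $0^{l}$ denotes a block of $l$ zeros. A set $S$ of positive integers is sum-free if there are no $x,y,z\in S$ ($x,y$ not necessarily distinct) with $x+y=z$. Cameron's bijection $\theta$ from infinite zero-one sequences to sum-free sets of positive integers: given $\mathbf{w}=w_0w_1\cdots$, examine $n=1,2,3,\dots$ in increasing order; if $n=x+y$ for some $x,y$ already placed in $S$ (possibly $x=y$), label $n$ by $\ast$ and $n\notin S$; otherwise read the next unread symbol of $\mathbf{w}$ and put $n\in S$ iff it is $1$. Then $\theta(\mathbf{w})=S$, listed increasingly as $S_0<S_1<\cdots$. A sequence $(t(n))_{n\ge0}$ is $2$-regular if the $\mathbb{Z}$-module generated by $\{(t(2^in+b))_{n\ge0}: i\ge0,\ 0\le b<2^i\}$ is finitely generated. -}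

module Defs where

open import Data.Bool using (Bool; true; false; if_then_else_; _∨_)
open import Data.Nat using (ℕ; zero; suc; _+_; _*_; _∸_; _^_; _<_; _≤ᵇ_; _≡ᵇ_)
open import Data.Integer using (ℤ; +_) renaming (_+_ to _+ℤ_; _*_ to _*ℤ_)
open import Data.List using (List; []; _∷_; _++_; concatMap; replicate)
open import Data.Bool.ListAction using (any)
open import Data.Fin using (Fin)
import Data.Fin as Fin
open import Data.Product using (Σ; ∃; _×_; _,_; proj₁; proj₂)
open import Relation.Binary.PropositionalEquality using (_≡_)

-- The substitution σ : 1 ↦ 1 0^{l1} 1 0^{l2},  0 ↦ 0^{l3}  (true = 1, false = 0)
σ : ℕ → ℕ → ℕ → Bool → List Bool
σ l1 l2 l3 true  = true ∷ replicate l1 false ++ true ∷ replicate l2 false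
σ l1 l2 l3 false = replicate l3 false

σ* : ℕ → ℕ → ℕ → List Bool → List Bool
σ* l1 l2 l3 = concatMap (σ l1 l2 l3)

σIter : ℕ → ℕ → ℕ → ℕ → List Bool
σIter l1 l2 l3 zero    = true ∷ []
σIter l1 l2 l3 (suc k) = σ* l1 l2 l3 (σIter l1 l2 l3 k)

-- i-th letter of a list (default false beyond its end)
at : List Bool → ℕ → Bool
at []       _       = false
at (x ∷ xs) zero    = x
at (x ∷ xs) (suc i) = at xs i

-- The fixed point c = σ^∞(1): c_i is the i-th letter of σ^{i+1}(1).
-- (σ^k(1) is a prefix of σ^{k+1}(1), and
-- σ^k(1) contains 2^k ones, so |σ^{i+1}(1)| > i and the default is never used.)
cantor : ℕ → ℕ → ℕ → ℕ → Bool
cantor l1 l2 l3 i = at (σIter l1 l2 l3 (suc i)) i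

_∈ᵇ_ : ℕ → List ℕ → Bool
m ∈ᵇ L = any (λ x → m ≡ᵇ x) L

isSum : List ℕ → ℕ → Bool
isSum L n = any (λ x → if x ≤ᵇ n then ((n ∸ x) ∈ᵇ L) else false) L

-- State after examining 1, …, n : (elements of S placed so far, number of
-- symbols of w read so far).
θState : (ℕ → Bool) → ℕ → List ℕ × ℕ
θState w zero = [] , 0
θState w (suc n) with θState w n
... | L , k = if isSum L (suc n) then (L , k)
              else (if w k then (suc n ∷ L , suc k) else (L , suc k))

-- m ∈ θ(w)   (m ≥ 1; 0 is never in θ(w))
inθ : (ℕ → Bool) → ℕ → Bool
inθ w m = m ∈ᵇ proj₁ (θState w m)

finSum : (r : ℕ) → (Fin r → ℤ) → ℤ
finSum zero    f = + 0
finSum (suc r) f = f Fin.zero +ℤ finSum r (λ j → f (Fin.suc j))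

In2Kernel : (ℕ → ℤ) → (ℕ → ℤ) → Set
In2Kernel t f = Σ ℕ λ i → Σ ℕ λ b → (b < 2 ^ i) × (∀ n → f n ≡ t (2 ^ i * n + b))

InSpan : ((ℕ → ℤ) → Set) → (ℕ → ℤ) → Set
InSpan P f = Σ ℕ λ r → Σ (Fin r → ℤ) λ c → Σ (Fin r → (ℕ → ℤ)) λ g →
  (∀ j → P (g j)) × (∀ n → f n ≡ finSum r (λ j → c j *ℤ g j n))

-- t is 2-regular: the ℤ-module generated by the 2-kernel of t is finitely
-- generated, i.e. it is spanned by finitely many of its elements.
TwoRegular : (ℕ → ℤ) → Set
TwoRegular t = Σ ℕ λ r → Σ (Fin r → (ℕ → ℤ)) λ g →
  (∀ j → InSpan (In2Kernel t) (g j)) ×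
  (∀ f → InSpan (In2Kernel t) f →
     Σ (Fin r → ℤ) λ c → ∀ n → f n ≡ finSum r (λ j → c j *ℤ g j n))

{-# OPTIONS --safe #-}
module Submission where

-- Write M k = |σᵏ(1)| + l₁ l₃ᵏ, so that σᵏ⁺¹(1) = σᵏ(1) 0^{l₁l₃ᵏ} σᵏ(1) 0^{l₂l₃ᵏ} and c has the
-- same letters at positions j and M k + j for j < M k, and put d k = 3ᵏ + M k.  The candidate set is
-- A = {S n}, S n = 1 + Σⱼ bitⱼ(n) d j: its part up to d (k + 1) consists of its part up to d k and the
-- translate of that by d k.  Because 3 d k ≤ d (k + 1), the sums x + y (x, y ∈ A) show the same
-- self-similarity, with exactly 3ᵏ of them up to d k, so that Cameron's procedure has read exactly M k
-- letters of c when it reaches d k.  An induction on k then shows that the two self-similarities match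
-- and the procedure accepts exactly the elements of A.  Finally S (2ⁱ n + b) = S b + Σⱼ bitⱼ(n) d (i + j),
-- and d satisfies a linear recurrence of order 3, so the 2-kernel of S lies in the span of
-- S (n), S (2n), S (4n), S (8n) and the constants d 0, d 1, d 2.

open import Data.Bool using (Bool; true; false; _∧_; _∨_; if_then_else_; T)
open import Data.Bool.Properties using (∨-identityʳ; ∨-zeroʳ; ∧-zeroʳ; ∧-identityʳ)
import Data.Bool.Properties as Bool
open import Data.Bool.ListAction using (any)
open import Data.Nat
open import Data.Nat.Properties
open import Data.Nat.Tactic.RingSolver using (solve-∀)
open import Algebra.Properties.CommutativeSemigroup *-commutativeSemigroup using () renaming (x∙yz≈y∙xz to x*[y*z]≡y*[x*z])
open import Data.List using (List; []; _∷_; _++_; replicate; length)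
open import Data.List.Properties using (++-assoc; ++-identityʳ; length-++; length-replicate; concatMap-++)
open import Data.Empty using (⊥-elim)
open import Data.Product using (Σ; ∃; ∃₂; _×_; _,_; proj₁; proj₂)
open import Data.Sum using (_⊎_; inj₁; inj₂)
open import Function using (_∘_; _⇔_; mk⇔; Equivalence)
open import Relation.Nullary using (Dec; yes; no; ¬_; does)
open import Relation.Nullary.Decidable using (map′; _×-dec_; dec-true; dec-false)
open import Relation.Binary.PropositionalEquality
open import Defs

bit : ℕ → ℕ
bit zero          = 0
bit (suc zero)    = 1
bit (suc (suc n)) = bit n

bit≤1 : ∀ n → bit n ≤ 1
bit≤1 zero          = z≤n
bit≤1 (suc zero)    = ≤-refl
bit≤1 (suc (suc n)) = bit≤1 n

b+2[1+n]≡2+b+2n : ∀ b n → b + 2 * suc n ≡ suc (suc (b + 2 * n))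
b+2[1+n]≡2+b+2n = solve-∀

bit+2*⌊n/2⌋≡n : ∀ n → bit n + 2 * ⌊ n /2⌋ ≡ n
bit+2*⌊n/2⌋≡n zero          = refl
bit+2*⌊n/2⌋≡n (suc zero)    = refl
bit+2*⌊n/2⌋≡n (suc (suc n)) =
  trans (b+2[1+n]≡2+b+2n (bit n) ⌊ n /2⌋) (cong (suc ∘ suc) (bit+2*⌊n/2⌋≡n n))

bit[b+2n]≡b : ∀ {b} n → b ≤ 1 → bit (b + 2 * n) ≡ b
bit[b+2n]≡b {zero}        zero    _          = refl
bit[b+2n]≡b {suc zero}    zero    _          = refl
bit[b+2n]≡b {suc (suc b)} zero    (s≤s ())
bit[b+2n]≡b {b}           (suc n) b≤1 =
  trans (cong bit (b+2[1+n]≡2+b+2n b n)) (bit[b+2n]≡b n b≤1)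

⌊b+2n/2⌋≡n : ∀ {b} n → b ≤ 1 → ⌊ b + 2 * n /2⌋ ≡ n
⌊b+2n/2⌋≡n {zero}        zero    _          = refl
⌊b+2n/2⌋≡n {suc zero}    zero    _          = refl
⌊b+2n/2⌋≡n {suc (suc b)} zero    (s≤s ())
⌊b+2n/2⌋≡n {b}           (suc n) b≤1 =
  trans (cong ⌊_/2⌋ (b+2[1+n]≡2+b+2n b n)) (cong suc (⌊b+2n/2⌋≡n n b≤1))

-- Σⱼ bitⱼ(n) * w j, where bitⱼ(n) is the j-th binary digit of n, computed with fuel f;
-- the fuel is irrelevant as soon as n ≤ f.
digitSumWith : ℕ → (ℕ → ℕ) → ℕ → ℕ
digitSumWith zero    w n = 0
digitSumWith (suc f) w n = bit n * w 0 + digitSumWith f (w ∘ suc) ⌊ n /2⌋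

digitSum : (ℕ → ℕ) → ℕ → ℕ
digitSum w n = digitSumWith n w n

digitSumWith-zero : ∀ f w → digitSumWith f w 0 ≡ 0
digitSumWith-zero zero    w = refl
digitSumWith-zero (suc f) w = digitSumWith-zero f (w ∘ suc)

digitSumWith-fuel : ∀ {f g} w n → n ≤ f → n ≤ g → digitSumWith f w n ≡ digitSumWith g w n
digitSumWith-fuel {f} {g} w zero _ _ = trans (digitSumWith-zero f w) (sym (digitSumWith-zero g w))
digitSumWith-fuel {suc f} {suc g} w (suc n) (s≤s n≤f) (s≤s n≤g) =
  cong (bit (suc n) * w 0 +_)
    (digitSumWith-fuel (w ∘ suc) ⌊ suc n /2⌋ (≤-trans half≤n n≤f) (≤-trans half≤n n≤g))
  where
  half≤n : ⌊ suc n /2⌋ ≤ n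
  half≤n = ≤-pred (⌊n/2⌋<n n)

digitSum-step : ∀ w {b} n → b ≤ 1 → digitSum w (b + 2 * n) ≡ b * w 0 + digitSum (w ∘ suc) n
digitSum-step w {b} n b≤1 = begin
  digitSumWith N w N
    ≡⟨ digitSumWith-fuel w N ≤-refl (n≤1+n N) ⟩
  bit N * w 0 + digitSumWith N (w ∘ suc) ⌊ N /2⌋
    ≡⟨ cong₂ (λ x y → x * w 0 + digitSumWith N (w ∘ suc) y) (bit[b+2n]≡b n b≤1) (⌊b+2n/2⌋≡n n b≤1) ⟩
  b * w 0 + digitSumWith N (w ∘ suc) n
    ≡⟨ cong (b * w 0 +_) (digitSumWith-fuel (w ∘ suc) n n≤N ≤-refl) ⟩
  b * w 0 + digitSum (w ∘ suc) n ∎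
  where
  open ≡-Reasoning
  N : ℕ
  N = b + 2 * n
  n≤N : n ≤ N
  n≤N = ≤-trans (m≤m+n n (n + 0)) (m≤n+m (2 * n) b)

digitSum-one : ∀ w → digitSum w 1 ≡ w 0
digitSum-one w = trans (+-identityʳ _) (+-identityʳ _)

-- The binary digits of 2^i * n + b (b < 2^i) are those of b followed by those of n.
digitSum-split : ∀ i w {b} n → b < 2 ^ i → digitSum w (2 ^ i * n + b) ≡ digitSum w b + digitSum (λ j → w (i + j)) n
digitSum-split zero w {zero} n _ = cong (digitSum w) (trans (+-identityʳ _) (+-identityʳ n))
digitSum-split zero w {suc b} n (s≤s ())
digitSum-split (suc i) w {b} n b<2^[1+i] = begin
  digitSum w (2 ^ suc i * n + b)
    ≡⟨ cong (digitSum w) regroup ⟩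
  digitSum w (bit b + 2 * (2 ^ i * n + ⌊ b /2⌋))
    ≡⟨ digitSum-step w (2 ^ i * n + ⌊ b /2⌋) (bit≤1 b) ⟩
  bit b * w 0 + digitSum (w ∘ suc) (2 ^ i * n + ⌊ b /2⌋)
    ≡⟨ cong (bit b * w 0 +_) (digitSum-split i (w ∘ suc) n half<2^i) ⟩
  bit b * w 0 + (digitSum (w ∘ suc) ⌊ b /2⌋ + digitSum (λ j → w (suc i + j)) n)
    ≡⟨ +-assoc (bit b * w 0) _ _ ⟨
  bit b * w 0 + digitSum (w ∘ suc) ⌊ b /2⌋ + digitSum (λ j → w (suc i + j)) n
    ≡⟨ cong (_+ digitSum (λ j → w (suc i + j)) n) (digitSum-step w ⌊ b /2⌋ (bit≤1 b)) ⟨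
  digitSum w (bit b + 2 * ⌊ b /2⌋) + digitSum (λ j → w (suc i + j)) n
    ≡⟨ cong (λ x → digitSum w x + digitSum (λ j → w (suc i + j)) n) (bit+2*⌊n/2⌋≡n b) ⟩
  digitSum w b + digitSum (λ j → w (suc i + j)) n ∎
  where
  open ≡-Reasoning
  shuffle : ∀ p h x n → 2 * x * n + (p + 2 * h) ≡ p + 2 * (x * n + h)
  shuffle = solve-∀
  regroup : 2 ^ suc i * n + b ≡ bit b + 2 * (2 ^ i * n + ⌊ b /2⌋)
  regroup = trans (cong (2 ^ suc i * n +_) (sym (bit+2*⌊n/2⌋≡n b))) (shuffle (bit b) ⌊ b /2⌋ (2 ^ i) n)
  half<2^i : ⌊ b /2⌋ < 2 ^ i
  half<2^i = *-cancelˡ-< 2 _ _ (≤-<-trans (m≤n+m (2 * ⌊ b /2⌋) (bit b))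
               (subst (_< 2 ^ suc i) (sym (bit+2*⌊n/2⌋≡n b)) b<2^[1+i]))

digitSumWith-+ : ∀ f u v n → digitSumWith f (λ j → u j + v j) n ≡ digitSumWith f u n + digitSumWith f v n
digitSumWith-+ zero    u v n = refl
digitSumWith-+ (suc f) u v n = trans
  (cong (bit n * (u 0 + v 0) +_) (digitSumWith-+ f (u ∘ suc) (v ∘ suc) ⌊ n /2⌋))
  (distribute (bit n) (u 0) (v 0) (digitSumWith f (u ∘ suc) ⌊ n /2⌋) (digitSumWith f (v ∘ suc) ⌊ n /2⌋))
  where
  distribute : ∀ b x y p q → b * (x + y) + (p + q) ≡ (b * x + p) + (b * y + q)
  distribute = solve-∀

digitSumWith-scale : ∀ f k w n → digitSumWith f (λ j → k * w j) n ≡ k * digitSumWith f w n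
digitSumWith-scale zero    k w n = sym (*-zeroʳ k)
digitSumWith-scale (suc f) k w n = trans
  (cong (bit n * (k * w 0) +_) (digitSumWith-scale f k (w ∘ suc) ⌊ n /2⌋))
  (distribute (bit n) k (w 0) (digitSumWith f (w ∘ suc) ⌊ n /2⌋))
  where
  distribute : ∀ b k x p → b * (k * x) + k * p ≡ k * (b * x + p)
  distribute = solve-∀

digitSumWith-cong : ∀ f {u v} n → (∀ j → u j ≡ v j) → digitSumWith f u n ≡ digitSumWith f v n
digitSumWith-cong zero    n _   = refl
digitSumWith-cong (suc f) n u≗v = cong₂ (λ x y → bit n * x + y) (u≗v 0) (digitSumWith-cong f ⌊ n /2⌋ (u≗v ∘ suc))

stepwise⇒mono-≤ : ∀ (f : ℕ → ℕ) → (∀ k → f k ≤ f (suc k)) → ∀ {k k′} → k ≤ k′ → f k ≤ f k′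
stepwise⇒mono-≤ f step {k} k≤k′ with m≤n⇒∃[o]m+o≡n k≤k′
... | e , refl = go e
  where
  go : ∀ e → f k ≤ f (k + e)
  go zero    = ≤-reflexive (cong f (sym (+-identityʳ k)))
  go (suc e) = ≤-trans (go e) (subst (f (k + e) ≤_) (cong f (sym (+-suc k e))) (step (k + e)))

n<2^n : ∀ n → n < 2 ^ n
n<2^n zero    = s≤s z≤n
n<2^n (suc n) = +-mono-≤ (m^n>0 2 n) (subst (n <_) (sym (+-identityʳ (2 ^ n))) (n<2^n n))

<2^[1+k]-split : ∀ k {n} → n < 2 ^ suc k → n < 2 ^ k ⊎ ∃ λ m → m < 2 ^ k × n ≡ 2 ^ k + m
<2^[1+k]-split k {n} n<2^[1+k] with n <? 2 ^ k
... | yes n<2^k = inj₁ n<2^k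
... | no  n≮2^k with m≤n⇒∃[o]m+o≡n (≮⇒≥ n≮2^k)
...   | m , refl = inj₂ (m , m<2^k , refl)
  where
  m<2^k : m < 2 ^ k
  m<2^k = +-cancelˡ-< (2 ^ k) m (2 ^ k) (subst (2 ^ k + m <_) (cong (2 ^ k +_) (+-identityʳ (2 ^ k))) n<2^[1+k])

replicate-+ : ∀ {A : Set} m n (x : A) → replicate m x ++ replicate n x ≡ replicate (m + n) x
replicate-+ zero    n x = refl
replicate-+ (suc m) n x = cong (x ∷_) (replicate-+ m n x)

at-beyond : ∀ xs {j} → length xs ≤ j → at xs j ≡ false
at-beyond []       _         = refl
at-beyond (x ∷ xs) (s≤s le) = at-beyond xs le

at-falses : ∀ m j → at (replicate m false) j ≡ false
at-falses zero    j       = refl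
at-falses (suc m) zero    = refl
at-falses (suc m) (suc j) = at-falses m j

at-++ˡ : ∀ xs ys {j} → j < length xs → at (xs ++ ys) j ≡ at xs j
at-++ˡ (x ∷ xs) ys {zero}  _         = refl
at-++ˡ (x ∷ xs) ys {suc j} (s≤s lt) = at-++ˡ xs ys lt

at-++ʳ : ∀ xs ys j → at (xs ++ ys) (length xs + j) ≡ at ys j
at-++ʳ []       ys j = refl
at-++ʳ (x ∷ xs) ys j = at-++ʳ xs ys j

at-++-falses : ∀ xs m j → at (xs ++ replicate m false) j ≡ at xs j
at-++-falses []       m j       = at-falses m j
at-++-falses (x ∷ xs) m zero    = refl
at-++-falses (x ∷ xs) m (suc j) = at-++-falses xs m j

any-∈ᵇ⁻ : ∀ (p : ℕ → Bool) L → any p L ≡ true → ∃ λ x → x ∈ᵇ L ≡ true × p x ≡ true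
any-∈ᵇ⁻ p (y ∷ L) eq with p y in py
... | true  = y , cong (_∨ (y ∈ᵇ L)) (dec-true (y ≟ y) refl) , py
... | false with any-∈ᵇ⁻ p L eq
...   | x , x∈L , px = x , trans (cong ((x ≡ᵇ y) ∨_) x∈L) (∨-zeroʳ _) , px

any-∈ᵇ⁺ : ∀ (p : ℕ → Bool) L {x} → x ∈ᵇ L ≡ true → p x ≡ true → any p L ≡ true
any-∈ᵇ⁺ p (y ∷ L) {x} x∈L px with x ≡ᵇ y in x≡ᵇy
... | true  rewrite ≡ᵇ⇒≡ x y (subst T (sym x≡ᵇy) _) | px = refl
... | false rewrite any-∈ᵇ⁺ p L x∈L px = ∨-zeroʳ _

≡true⇔⇒≡does : ∀ {A : Set} {b} (a? : Dec A) → (b ≡ true → A) → (A → b ≡ true) → b ≡ does a?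
≡true⇔⇒≡does (yes a) _ complete = complete a
≡true⇔⇒≡does {b = false} (no ¬a) _ _ = refl
≡true⇔⇒≡does {b = true} (no ¬a) sound _ = ⊥-elim (¬a (sound refl))

∧≡true⇒ : ∀ {b b′} → (b ∧ b′) ≡ true → b ≡ true × b′ ≡ true
∧≡true⇒ {true} {true} _ = refl , refl

-- The Cantor-like sequence and its sum-free set

module Cantor (l₁ l₂ l₃ : ℕ) (3≤l₃ : 3 ≤ l₃) (1≤l₁+l₂ : 1 ≤ l₁ + l₂) where

  -- L k = |σᵏ(1)|; the second copy of σᵏ(1) in σᵏ⁺¹(1) starts at position M k.
  L : ℕ → ℕ
  L zero    = 1
  L (suc k) = 2 * L k + (l₁ + l₂) * l₃ ^ k

  M : ℕ → ℕ
  M k = L k + l₁ * l₃ ^ k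

  -- S n = 1 + Σⱼ bitⱼ(n) d j (defined below); B k = S (2ᵏ - 1) is the largest of S 0, …, S (2ᵏ - 1)
  -- and R k the largest sum of two of them.
  d : ℕ → ℕ
  d k = 3 ^ k + M k

  B : ℕ → ℕ
  B zero    = 1
  B (suc k) = d k + B k

  R : ℕ → ℕ
  R k = B k + B k

  L≤[l₁+l₂]l₃^k : ∀ k → L k ≤ (l₁ + l₂) * l₃ ^ k
  L≤[l₁+l₂]l₃^k zero = subst (1 ≤_) (sym (*-identityʳ _)) 1≤l₁+l₂
  L≤[l₁+l₂]l₃^k (suc k) = begin
    2 * L k + a * l₃ ^ k         ≤⟨ +-monoˡ-≤ (a * l₃ ^ k) (*-monoʳ-≤ 2 (L≤[l₁+l₂]l₃^k k)) ⟩
    2 * (a * l₃ ^ k) + a * l₃ ^ k ≡⟨ 2x+x≡3x (a * l₃ ^ k) ⟩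
    3 * (a * l₃ ^ k)             ≤⟨ *-monoˡ-≤ (a * l₃ ^ k) 3≤l₃ ⟩
    l₃ * (a * l₃ ^ k)            ≡⟨ x*[y*z]≡y*[x*z] l₃ a (l₃ ^ k) ⟩
    a * (l₃ * l₃ ^ k)            ∎
    where
    open ≤-Reasoning
    a : ℕ
    a = l₁ + l₂
    2x+x≡3x : ∀ x → 2 * x + x ≡ 3 * x
    2x+x≡3x = solve-∀

  3*d≤d[1+k] : ∀ k → 3 * d k ≤ d (suc k)
  3*d≤d[1+k] k = begin
    3 * (3 ^ k + (L k + l₁ * l₃ ^ k))                      ≡⟨ expand (3 ^ k) (L k) (l₁ * l₃ ^ k) ⟩
    3 * 3 ^ k + (2 * L k + L k + 3 * (l₁ * l₃ ^ k))
      ≤⟨ +-monoʳ-≤ (3 * 3 ^ k) (+-mono-≤ (+-monoʳ-≤ (2 * L k) (L≤[l₁+l₂]l₃^k k)) (*-monoˡ-≤ (l₁ * l₃ ^ k) 3≤l₃)) ⟩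
    3 * 3 ^ k + (2 * L k + (l₁ + l₂) * l₃ ^ k + l₃ * (l₁ * l₃ ^ k))
      ≡⟨ cong (λ z → 3 * 3 ^ k + (L (suc k) + z)) (x*[y*z]≡y*[x*z] l₃ l₁ (l₃ ^ k)) ⟩
    d (suc k)                                              ∎
    where
    open ≤-Reasoning
    expand : ∀ x y z → 3 * (x + (y + z)) ≡ 3 * x + (2 * y + y + 3 * z)
    expand = solve-∀

  R≤d : ∀ k → R k ≤ d k
  d+d+R≤d[1+k] : ∀ k → d k + d k + R k ≤ d (suc k)

  R≤d zero    = s≤s (s≤s z≤n)
  R≤d (suc k) = subst (_≤ d (suc k)) (sym (shuffle (d k) (B k))) (d+d+R≤d[1+k] k)
    where
    shuffle : ∀ x y → x + y + (x + y) ≡ x + x + (y + y)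
    shuffle = solve-∀

  d+d+R≤d[1+k] k = begin
    d k + d k + R k ≤⟨ +-monoʳ-≤ (d k + d k) (R≤d k) ⟩
    d k + d k + d k ≡⟨ x+x+x≡3x (d k) ⟩
    3 * d k         ≤⟨ 3*d≤d[1+k] k ⟩
    d (suc k)       ∎
    where
    open ≤-Reasoning
    x+x+x≡3x : ∀ x → x + x + x ≡ 3 * x
    x+x+x≡3x = solve-∀

  d+d≤d[1+k] : ∀ k → d k + d k ≤ d (suc k)
  d+d≤d[1+k] k = ≤-trans (m≤m+n (d k + d k) (R k)) (d+d+R≤d[1+k] k)

  d≤d[1+k] : ∀ k → d k ≤ d (suc k)
  d≤d[1+k] k = ≤-trans (m≤m+n (d k) (d k + R k)) (subst (_≤ d (suc k)) (+-assoc (d k) (d k) (R k)) (d+d+R≤d[1+k] k))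

  0<B : ∀ k → 0 < B k
  0<B zero    = s≤s z≤n
  0<B (suc k) = ≤-trans (0<B k) (m≤n+m (B k) (d k))

  B<R : ∀ k → B k < R k
  B<R k = m<m+n (B k) (0<B k)

  B≤d : ∀ k → B k ≤ d k
  B≤d k = ≤-trans (m≤m+n (B k) (B k)) (R≤d k)

  k<B : ∀ k → k < B k
  k<B zero    = s≤s z≤n
  k<B (suc k) = ≤-trans (s≤s (k<B k)) (+-monoˡ-≤ (B k) (≤-trans (0<B k) (B≤d k)))

  k<d : ∀ k → k < d k
  k<d k = ≤-trans (k<B k) (B≤d k)

  M+M≤M[1+k] : ∀ k → M k + M k ≤ M (suc k)
  M+M≤M[1+k] k = begin
    M k + M k                       ≡⟨ double (L k) (l₁ * l₃ ^ k) ⟩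
    2 * L k + 2 * (l₁ * l₃ ^ k)     ≤⟨ +-monoʳ-≤ (2 * L k) (*-monoˡ-≤ (l₁ * l₃ ^ k) (≤-trans (n≤1+n 2) 3≤l₃)) ⟩
    2 * L k + l₃ * (l₁ * l₃ ^ k)    ≡⟨ cong (2 * L k +_) (x*[y*z]≡y*[x*z] l₃ l₁ (l₃ ^ k)) ⟩
    2 * L k + l₁ * (l₃ * l₃ ^ k)    ≤⟨ +-monoˡ-≤ (l₁ * (l₃ * l₃ ^ k)) (m≤m+n (2 * L k) _) ⟩
    M (suc k)                       ∎
    where
    open ≤-Reasoning
    double : ∀ x y → x + y + (x + y) ≡ 2 * x + 2 * y
    double = solve-∀

  M≤M[1+k] : ∀ k → M k ≤ M (suc k)
  M≤M[1+k] k = ≤-trans (m≤m+n (M k) (M k)) (M+M≤M[1+k] k)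

  k<M : ∀ k → k < M k
  k<M zero    = s≤s z≤n
  k<M (suc k) = ≤-trans (+-mono-≤ (≤-trans (s≤s z≤n) (k<M k)) (k<M k)) (M+M≤M[1+k] k)

  σᵏ : ℕ → List Bool
  σᵏ = σIter l₁ l₂ l₃

  c : ℕ → Bool
  c = cantor l₁ l₂ l₃

  falses : ℕ → List Bool
  falses m = replicate m false

  σ*-falses : ∀ m → σ* l₁ l₂ l₃ (falses m) ≡ falses (m * l₃)
  σ*-falses zero    = refl
  σ*-falses (suc m) = trans (cong (falses l₃ ++_) (σ*-falses m)) (replicate-+ l₃ (m * l₃) false)

  σᵏ⁺¹ : ∀ k → σᵏ (suc k) ≡ σᵏ k ++ falses (l₁ * l₃ ^ k) ++ σᵏ k ++ falses (l₂ * l₃ ^ k)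
  σᵏ⁺¹ zero rewrite *-identityʳ l₁ | *-identityʳ l₂ = ++-identityʳ _
  σᵏ⁺¹ (suc k) = begin
    σ⁺ (σᵏ (suc k))                              ≡⟨ cong σ⁺ (σᵏ⁺¹ k) ⟩
    σ⁺ (σᵏ k ++ falses p ++ σᵏ k ++ falses q)
      ≡⟨ trans (concatMap-++ (σ l₁ l₂ l₃) (σᵏ k) _)
          (cong (σᵏ (suc k) ++_) (trans (concatMap-++ (σ l₁ l₂ l₃) (falses p) _)
            (cong (σ⁺ (falses p) ++_) (concatMap-++ (σ l₁ l₂ l₃) (σᵏ k) (falses q))))) ⟩
    σᵏ (suc k) ++ σ⁺ (falses p) ++ σᵏ (suc k) ++ σ⁺ (falses q)
      ≡⟨ cong₂ (λ u v → σᵏ (suc k) ++ u ++ σᵏ (suc k) ++ v)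
           (trans (σ*-falses p) (cong falses (rescale l₁))) (trans (σ*-falses q) (cong falses (rescale l₂))) ⟩
    σᵏ (suc k) ++ falses (l₁ * l₃ ^ suc k) ++ σᵏ (suc k) ++ falses (l₂ * l₃ ^ suc k) ∎
    where
    open ≡-Reasoning
    σ⁺ : List Bool → List Bool
    σ⁺ = σ* l₁ l₂ l₃
    p q : ℕ
    p = l₁ * l₃ ^ k
    q = l₂ * l₃ ^ k
    rescale : ∀ x → x * l₃ ^ k * l₃ ≡ x * (l₃ * l₃ ^ k)
    rescale x = trans (*-assoc x (l₃ ^ k) l₃) (cong (x *_) (*-comm (l₃ ^ k) l₃))

  length-σᵏ : ∀ k → length (σᵏ k) ≡ L k
  length-σᵏ zero    = refl
  length-σᵏ (suc k) = begin
    length (σᵏ (suc k))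
      ≡⟨ cong length (σᵏ⁺¹ k) ⟩
    length (σᵏ k ++ falses p ++ σᵏ k ++ falses q)
      ≡⟨ trans (length-++ (σᵏ k)) (cong (length (σᵏ k) +_) (trans (length-++ (falses p))
           (cong₂ _+_ (length-replicate p) (trans (length-++ (σᵏ k)) (cong (length (σᵏ k) +_) (length-replicate q)))))) ⟩
    length (σᵏ k) + (p + (length (σᵏ k) + q))
      ≡⟨ cong (λ x → x + (p + (x + q))) (length-σᵏ k) ⟩
    L k + (l₁ * l₃ ^ k + (L k + l₂ * l₃ ^ k))
      ≡⟨ regroup (L k) l₁ l₂ (l₃ ^ k) ⟩
    L (suc k) ∎
    where
    open ≡-Reasoning
    p q : ℕ
    p = l₁ * l₃ ^ k
    q = l₂ * l₃ ^ k
    regroup : ∀ x y z w → x + (y * w + (x + z * w)) ≡ 2 * x + (y + z) * w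
    regroup = solve-∀

  at-σᵏ⁺¹-prefix : ∀ k {j} → j < M k → at (σᵏ (suc k)) j ≡ at (σᵏ k) j
  at-σᵏ⁺¹-prefix k {j} j<M rewrite σᵏ⁺¹ k = begin
    at (σᵏ k ++ falses p ++ σᵏ k ++ falses q) j   ≡⟨ cong (λ w → at w j) (++-assoc (σᵏ k) (falses p) _) ⟨
    at ((σᵏ k ++ falses p) ++ σᵏ k ++ falses q) j ≡⟨ at-++ˡ (σᵏ k ++ falses p) _ j<length ⟩
    at (σᵏ k ++ falses p) j                       ≡⟨ at-++-falses (σᵏ k) p j ⟩
    at (σᵏ k) j                                   ∎
    where
    open ≡-Reasoning
    p q : ℕ
    p = l₁ * l₃ ^ k
    q = l₂ * l₃ ^ k
    j<length : j < length (σᵏ k ++ falses p)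
    j<length = subst (j <_) (sym (trans (length-++ (σᵏ k)) (cong₂ _+_ (length-σᵏ k) (length-replicate p)))) j<M

  at-σᵏ⁺¹-copy : ∀ k j → at (σᵏ (suc k)) (M k + j) ≡ at (σᵏ k) j
  at-σᵏ⁺¹-copy k j rewrite σᵏ⁺¹ k = begin
    at (σᵏ k ++ falses p ++ σᵏ k ++ falses q) (L k + p + j)
      ≡⟨ cong (at (σᵏ k ++ falses p ++ σᵏ k ++ falses q))
           (trans (+-assoc (L k) p j) (cong₂ (λ x y → x + (y + j)) (sym (length-σᵏ k)) (sym (length-replicate p)))) ⟩
    at (σᵏ k ++ falses p ++ σᵏ k ++ falses q) (length (σᵏ k) + (length (falses p) + j))
      ≡⟨ at-++ʳ (σᵏ k) _ (length (falses p) + j) ⟩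
    at (falses p ++ σᵏ k ++ falses q) (length (falses p) + j)
      ≡⟨ at-++ʳ (falses p) _ j ⟩
    at (σᵏ k ++ falses q) j
      ≡⟨ at-++-falses (σᵏ k) q j ⟩
    at (σᵏ k) j ∎
    where
    open ≡-Reasoning
    p q : ℕ
    p = l₁ * l₃ ^ k
    q = l₂ * l₃ ^ k

  at-σᵏ-stable : ∀ k e {j} → j < M k → at (σᵏ (k + e)) j ≡ at (σᵏ k) j
  at-σᵏ-stable k zero    {j} _   = cong (λ i → at (σᵏ i) j) (+-identityʳ k)
  at-σᵏ-stable k (suc e) {j} j<M = begin
    at (σᵏ (k + suc e)) j   ≡⟨ cong (λ i → at (σᵏ i) j) (+-suc k e) ⟩
    at (σᵏ (suc (k + e))) j ≡⟨ at-σᵏ⁺¹-prefix (k + e) (≤-trans j<M (stepwise⇒mono-≤ M M≤M[1+k] (m≤m+n k e))) ⟩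
    at (σᵏ (k + e)) j       ≡⟨ at-σᵏ-stable k e j<M ⟩
    at (σᵏ k) j             ∎
    where open ≡-Reasoning

  c≡at-σᵏ : ∀ k {j} → j < M k → c j ≡ at (σᵏ k) j
  c≡at-σᵏ k {j} j<M = begin
    at (σᵏ (suc j)) j     ≡⟨ at-σᵏ-stable (suc j) k (≤-trans (n≤1+n (suc j)) (k<M (suc j))) ⟨
    at (σᵏ (suc j + k)) j ≡⟨ cong (λ i → at (σᵏ i) j) (+-comm (suc j) k) ⟩
    at (σᵏ (k + suc j)) j ≡⟨ at-σᵏ-stable k (suc j) j<M ⟩
    at (σᵏ k) j           ∎
    where open ≡-Reasoning

  c-periodic : ∀ k {j} → j < M k → c (M k + j) ≡ c j
  c-periodic k {j} j<M = begin
    c (M k + j)                ≡⟨ c≡at-σᵏ (suc k) (≤-trans (+-monoʳ-< (M k) j<M) (M+M≤M[1+k] k)) ⟩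
    at (σᵏ (suc k)) (M k + j)  ≡⟨ at-σᵏ⁺¹-copy k j ⟩
    at (σᵏ k) j                ≡⟨ c≡at-σᵏ k j<M ⟨
    c j                        ∎
    where open ≡-Reasoning

  c-gap : ∀ k {j} → M k + M k ≤ j → j < M (suc k) → c j ≡ false
  c-gap k {j} M+M≤j j<M with m≤n⇒∃[o]m+o≡n (≤-trans (m≤m+n (M k) (M k)) M+M≤j)
  ... | i , refl = begin
    c (M k + i)               ≡⟨ c≡at-σᵏ (suc k) j<M ⟩
    at (σᵏ (suc k)) (M k + i) ≡⟨ at-σᵏ⁺¹-copy k i ⟩
    at (σᵏ k) i               ≡⟨ at-beyond (σᵏ k) (≤-trans (≤-reflexive (length-σᵏ k)) (≤-trans (m≤m+n (L k) _) M≤i)) ⟩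
    false                     ∎
    where
    open ≡-Reasoning
    M≤i : M k ≤ i
    M≤i = +-cancelˡ-≤ (M k) _ _ M+M≤j

  c-initial-gap : ∀ {j} → 0 < j → j < M 0 → c j ≡ false
  c-initial-gap {suc j} _ j<M = c≡at-σᵏ 0 j<M

  S : ℕ → ℕ
  S n = suc (digitSum d n)

  G : ℕ → ℕ → ℕ
  G i = digitSum (λ j → d (i + j))

  S-split : ∀ i {b} n → b < 2 ^ i → S (2 ^ i * n + b) ≡ S b + G i n
  S-split i n b<2^i = cong suc (digitSum-split i d n b<2^i)

  S-shift : ∀ k {n} → n < 2 ^ k → S (2 ^ k + n) ≡ d k + S n
  S-shift k {n} n<2^k = begin
    S (2 ^ k + n)     ≡⟨ cong (λ x → S (x + n)) (*-identityʳ (2 ^ k)) ⟨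
    S (2 ^ k * 1 + n) ≡⟨ S-split k 1 n<2^k ⟩
    S n + G k 1       ≡⟨ cong (S n +_) (trans (digitSum-one (λ j → d (k + j))) (cong d (+-identityʳ k))) ⟩
    S n + d k         ≡⟨ +-comm (S n) (d k) ⟩
    d k + S n         ∎
    where open ≡-Reasoning

  -- level k m tells whether m ∈ {S n ∣ n < 2ᵏ}.
  level : ℕ → ℕ → Bool
  level zero    m = m ≡ᵇ 1
  level (suc k) m = level k m ∨ level k (m ∸ d k)

  level-0 : ∀ k → level k 0 ≡ false
  level-0 zero    = refl
  level-0 (suc k) = cong₂ _∨_ (level-0 k) (trans (cong (level k) (0∸n≡0 (d k))) (level-0 k))

  level-above : ∀ k {m} → B k < m → level k m ≡ false
  level-above zero {suc (suc m)} _ = refl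
  level-above zero {suc zero} (s≤s ())
  level-above (suc k) {m} B<m =
    cong₂ _∨_ (level-above k (≤-trans (s≤s (m≤n+m (B k) (d k))) B<m))
              (level-above k (+-cancelˡ-< (d k) (B k) (m ∸ d k) (≤-trans B<m (m≤n+m∸n m (d k)))))

  level-below-d : ∀ k {m} → m ≤ d k → level (suc k) m ≡ level k m
  level-below-d k {m} m≤d = trans (cong (λ x → level k m ∨ level k x) (m≤n⇒m∸n≡0 m≤d))
                                  (trans (cong (level k m ∨_) (level-0 k)) (∨-identityʳ _))

  level-stable : ∀ k e {m} → m ≤ d k → level (k + e) m ≡ level k m
  level-stable k zero    {m} _   = cong (λ i → level i m) (+-identityʳ k)
  level-stable k (suc e) {m} m≤d = begin
    level (k + suc e) m   ≡⟨ cong (λ i → level i m) (+-suc k e) ⟩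
    level (suc (k + e)) m ≡⟨ level-below-d (k + e) (≤-trans m≤d (stepwise⇒mono-≤ d d≤d[1+k] (m≤m+n k e))) ⟩
    level (k + e) m       ≡⟨ level-stable k e m≤d ⟩
    level k m             ∎
    where open ≡-Reasoning

  inA : ℕ → Bool
  inA m = level m m

  inA≡level : ∀ k {m} → m ≤ d k → inA m ≡ level k m
  inA≡level k {m} m≤d = begin
    level m m       ≡⟨ level-stable m k (<⇒≤ (k<d m)) ⟨
    level (m + k) m ≡⟨ cong (λ i → level i m) (+-comm m k) ⟩
    level (k + m) m ≡⟨ level-stable k m m≤d ⟩
    level k m       ∎
    where open ≡-Reasoning

  inA-gap : ∀ k {m} → B k < m → m ≤ d k → inA m ≡ false
  inA-gap k B<m m≤d = trans (inA≡level k m≤d) (level-above k B<m)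

  inA-shift : ∀ k {m} → m ≤ d k → inA (d k + m) ≡ inA m
  inA-shift k {m} m≤d = begin
    inA (d k + m)                          ≡⟨ inA≡level (suc k) d+m≤d[1+k] ⟩
    level k (d k + m) ∨ level k (d k + m ∸ d k)
      ≡⟨ cong₂ _∨_ (level-above k (≤-trans (B<R k) (≤-trans (R≤d k) (m≤m+n (d k) m)))) (cong (level k) (m+n∸m≡n (d k) m)) ⟩
    level k m                              ≡⟨ inA≡level k m≤d ⟨
    inA m                                  ∎
    where
    open ≡-Reasoning
    d+m≤d[1+k] : d k + m ≤ d (suc k)
    d+m≤d[1+k] = ≤-trans (+-monoʳ-≤ (d k) m≤d) (d+d≤d[1+k] k)

  level-S : ∀ k {n} → n < 2 ^ k → level k (S n) ≡ true
  level-S zero    {zero}  _ = refl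
  level-S zero    {suc n} (s≤s ())
  level-S (suc k) {n} n<2^[1+k] with <2^[1+k]-split k n<2^[1+k]
  ... | inj₁ n<2^k = cong (_∨ level k (S n ∸ d k)) (level-S k n<2^k)
  ... | inj₂ (m , m<2^k , refl) rewrite S-shift k m<2^k | m+n∸m≡n (d k) (S m) | level-S k m<2^k = ∨-zeroʳ _

  level-S⁻ : ∀ k {m} → level k m ≡ true → ∃ λ n → n < 2 ^ k × S n ≡ m
  level-S⁻ zero    {m} eq = 0 , s≤s z≤n , sym (≡ᵇ⇒≡ m 1 (subst T (sym eq) _))
  level-S⁻ (suc k) {m} eq with level k m in inLow | level k (m ∸ d k) in inHigh
  ... | true | _ with level-S⁻ k inLow
  ...   | n , n<2^k , refl = n , ≤-trans n<2^k (m≤m+n (2 ^ k) _) , refl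
  level-S⁻ (suc k) {m} eq | false | true with level-S⁻ k inHigh
  ...   | n , n<2^k , Sn≡m∸d = 2 ^ k + n , +-monoʳ-< (2 ^ k) (subst (n <_) (sym (+-identityʳ (2 ^ k))) n<2^k) ,
           (begin
             S (2 ^ k + n)  ≡⟨ S-shift k n<2^k ⟩
             d k + S n      ≡⟨ cong (d k +_) Sn≡m∸d ⟩
             d k + (m ∸ d k) ≡⟨ m+[n∸m]≡n d≤m ⟩
             m              ∎)
    where
    open ≡-Reasoning
    d≤m : d k ≤ m
    d≤m with d k ≤? m
    ... | yes d≤m = d≤m
    ... | no  d≰m with () ← trans (sym (level-0 k)) (trans (cong (level k) (sym (m≤n⇒m∸n≡0 (<⇒≤ (≰⇒> d≰m))))) inHigh)
  level-S⁻ (suc k) () | false | false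

  S≤B : ∀ k {n} → n < 2 ^ k → S n ≤ B k
  S≤B k {n} n<2^k with S n ≤? B k
  ... | yes S≤B = S≤B
  ... | no  S≰B with () ← trans (sym (level-above k (≰⇒> S≰B))) (level-S k n<2^k)

  inA-S : ∀ n → inA (S n) ≡ true
  inA-S n = trans (inA≡level n (≤-trans (S≤B n (n<2^n n)) (B≤d n))) (level-S n (n<2^n n))

  inA⇒S : ∀ {m} → inA m ≡ true → ∃ λ n → S n ≡ m
  inA⇒S {m} eq with level-S⁻ m eq
  ... | n , _ , Sn≡m = n , Sn≡m

  S-increasing : ∀ n → S n < S (suc n)
  S-increasing n = go (suc n) (n<2^n (suc n))
    where
    go : ∀ k {n} → suc n < 2 ^ k → S n < S (suc n)
    go zero (s≤s ())
    go (suc k) {n} 1+n<2^[1+k] with <2^[1+k]-split k 1+n<2^[1+k]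
    ... | inj₁ 1+n<2^k = go k 1+n<2^k
    ... | inj₂ (zero , 0<2^k , eq) = begin-strict
      S n         ≤⟨ S≤B k (subst (n <_) (+-identityʳ (2 ^ k)) (≤-reflexive eq)) ⟩
      B k         <⟨ ≤-trans (B<R k) (≤-trans (R≤d k) (m≤m+n (d k) 0)) ⟩
      d k + 0     <⟨ +-monoʳ-< (d k) (s≤s z≤n) ⟩
      d k + S 0   ≡⟨ S-shift k 0<2^k ⟨
      S (2 ^ k + 0) ≡⟨ cong S eq ⟨
      S (suc n)   ∎
      where open ≤-Reasoning
    ... | inj₂ (suc m , 1+m<2^k , eq) = begin-strict
      S n             ≡⟨ cong S (suc-injective (trans eq (+-suc (2 ^ k) m))) ⟩
      S (2 ^ k + m)   ≡⟨ S-shift k (<⇒≤ 1+m<2^k) ⟩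
      d k + S m       <⟨ +-monoʳ-< (d k) (go k 1+m<2^k) ⟩
      d k + S (suc m) ≡⟨ S-shift k 1+m<2^k ⟨
      S (2 ^ k + suc m) ≡⟨ cong S eq ⟨
      S (suc n)       ∎
      where open ≤-Reasoning

  IsSum : ℕ → Set
  IsSum m = ∃₂ λ x y → inA x ≡ true × inA y ≡ true × x + y ≡ m

  inA⇒0< : ∀ x → inA x ≡ true → 0 < x
  inA⇒0< (suc x) _ = s≤s z≤n

  isSum? : ∀ m → Dec (IsSum m)
  isSum? m = map′ fromBelow toBelow (anyUpTo? (λ x → (inA x Bool.≟ true) ×-dec (inA (m ∸ x) Bool.≟ true)) m)
    where
    fromBelow : (∃ λ x → x < m × inA x ≡ true × inA (m ∸ x) ≡ true) → IsSum m
    fromBelow (x , x<m , x∈A , m∸x∈A) = x , m ∸ x , x∈A , m∸x∈A , m+[n∸m]≡n (<⇒≤ x<m)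
    toBelow : IsSum m → ∃ λ x → x < m × inA x ≡ true × inA (m ∸ x) ≡ true
    toBelow (x , y , x∈A , y∈A , refl) =
      x , m<m+n x (inA⇒0< y y∈A) , x∈A , subst (λ z → inA z ≡ true) (sym (m+n∸m≡n x y)) y∈A

  inA⇒≤B : ∀ k {x} → inA x ≡ true → x ≤ d k → x ≤ B k
  inA⇒≤B k {x} x∈A x≤d with x ≤? B k
  ... | yes x≤B = x≤B
  ... | no  x≰B with () ← trans (sym (inA-gap k (≰⇒> x≰B) x≤d)) x∈A

  LowOrShifted : ℕ → ℕ → Set
  LowOrShifted k x = x ≤ B k ⊎ ∃ λ x′ → x ≡ d k + x′ × x′ ≤ B k × inA x′ ≡ true

  inA-split : ∀ k {x} → inA x ≡ true → x ≤ d (suc k) → LowOrShifted k x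
  inA-split k {x} x∈A x≤d[1+k] with x ≤? d k
  ... | yes x≤d = inj₁ (inA⇒≤B k x∈A x≤d)
  ... | no  x≰d with m≤n⇒∃[o]m+o≡n (<⇒≤ (≰⇒> x≰d))
  ...   | x′ , refl = inj₂ (x′ , refl , x′≤B , trans (sym (inA-shift k (≤-trans x′≤B (B≤d k)))) x∈A)
    where
    x′≤B : x′ ≤ B k
    x′≤B = +-cancelˡ-≤ (d k) x′ (B k) (inA⇒≤B (suc k) x∈A x≤d[1+k])

  lowOrShifted⇒≤d+B : ∀ k {x} → LowOrShifted k x → x ≤ d k + B k
  lowOrShifted⇒≤d+B k (inj₁ x≤B)                    = ≤-trans x≤B (m≤n+m (B k) (d k))
  lowOrShifted⇒≤d+B k (inj₂ (x′ , refl , x′≤B , _)) = +-monoʳ-≤ (d k) x′≤B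

  ¬IsSum-gap : ∀ k {n} → R k < n → n ≤ d k → ¬ IsSum n
  ¬IsSum-gap k R<n n≤d (x , y , x∈A , y∈A , refl) =
    <⇒≱ R<n (+-mono-≤ (inA⇒≤B k x∈A (≤-trans (m≤m+n x y) n≤d)) (inA⇒≤B k y∈A (≤-trans (m≤n+m y x) n≤d)))

  IsSum-shift : ∀ k {m} → 0 < m → m ≤ d k → IsSum (d k + m) ⇔ IsSum m
  IsSum-shift k {m} 0<m m≤d = mk⇔ unshift shift
    where
    d+m≤d[1+k] : d k + m ≤ d (suc k)
    d+m≤d[1+k] = ≤-trans (+-monoʳ-≤ (d k) m≤d) (d+d≤d[1+k] k)
    unshift : IsSum (d k + m) → IsSum m
    unshift (x , y , x∈A , y∈A , x+y≡d+m)
      with inA-split k x∈A (≤-trans (m≤m+n x y) (≤-trans (≤-reflexive x+y≡d+m) d+m≤d[1+k]))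
         | inA-split k y∈A (≤-trans (m≤n+m y x) (≤-trans (≤-reflexive x+y≡d+m) d+m≤d[1+k]))
    ... | inj₂ (x′ , refl , _ , x′∈A) | _ =
      x′ , y , x′∈A , y∈A , +-cancelˡ-≡ (d k) _ _ (trans (sym (+-assoc (d k) x′ y)) x+y≡d+m)
    ... | inj₁ _ | inj₂ (y′ , refl , _ , y′∈A) =
      x , y′ , x∈A , y′∈A , +-cancelˡ-≡ (d k) _ _ (trans (d+[x+y]≡x+[d+y] x (d k) y′) x+y≡d+m)
      where
      d+[x+y]≡x+[d+y] : ∀ x d y → d + (x + y) ≡ x + (d + y)
      d+[x+y]≡x+[d+y] = solve-∀
    ... | inj₁ x≤B | inj₁ y≤B = ⊥-elim (<⇒≱ (≤-trans (s≤s (≤-trans (+-mono-≤ x≤B y≤B) (R≤d k))) (m<m+n (d k) 0<m))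
                                                (≤-reflexive (sym x+y≡d+m)))
    shift : IsSum m → IsSum (d k + m)
    shift (x , y , x∈A , y∈A , refl) =
      d k + x , y , trans (inA-shift k (≤-trans (m≤m+n x y) m≤d)) x∈A , y∈A , +-assoc (d k) x y

  IsSum-shift₂ : ∀ k {m} → 0 < m → m ≤ R k → IsSum (d k + d k + m) ⇔ IsSum m
  IsSum-shift₂ k {m} 0<m m≤R = mk⇔ unshift shift
    where
    2d+m≤d[1+k] : d k + d k + m ≤ d (suc k)
    2d+m≤d[1+k] = ≤-trans (+-monoʳ-≤ (d k + d k) m≤R) (d+d+R≤d[1+k] k)
    d+R<2d+m : d k + R k < d k + d k + m
    d+R<2d+m = ≤-trans (s≤s (+-monoʳ-≤ (d k) (R≤d k))) (m<m+n (d k + d k) 0<m)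
    unshift : IsSum (d k + d k + m) → IsSum m
    unshift (x , y , x∈A , y∈A , x+y≡2d+m)
      with inA-split k x∈A (≤-trans (m≤m+n x y) (≤-trans (≤-reflexive x+y≡2d+m) 2d+m≤d[1+k]))
         | inA-split k y∈A (≤-trans (m≤n+m y x) (≤-trans (≤-reflexive x+y≡2d+m) 2d+m≤d[1+k]))
    ... | inj₂ (x′ , refl , _ , x′∈A) | inj₂ (y′ , refl , _ , y′∈A) =
      x′ , y′ , x′∈A , y′∈A , +-cancelˡ-≡ (d k + d k) _ _ (trans (regroup (d k) x′ y′) x+y≡2d+m)
      where
      regroup : ∀ d x y → d + d + (x + y) ≡ d + x + (d + y)
      regroup = solve-∀
    ... | inj₁ x≤B | y-split = ⊥-elim (<⇒≱ (≤-<-trans (≤-trans (+-mono-≤ x≤B (lowOrShifted⇒≤d+B k y-split))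
                                                        (≤-reflexive (b+[d+b]≡d+[b+b] (B k) (d k)))) d+R<2d+m)
                                          (≤-reflexive (sym x+y≡2d+m)))
      where
      b+[d+b]≡d+[b+b] : ∀ b d → b + (d + b) ≡ d + (b + b)
      b+[d+b]≡d+[b+b] = solve-∀
    ... | x-split | inj₁ y≤B = ⊥-elim (<⇒≱ (≤-<-trans (≤-trans (+-mono-≤ (lowOrShifted⇒≤d+B k x-split) y≤B)
                                                        (≤-reflexive (+-assoc (d k) (B k) (B k)))) d+R<2d+m)
                                          (≤-reflexive (sym x+y≡2d+m)))
    shift : IsSum m → IsSum (d k + d k + m)
    shift (x , y , x∈A , y∈A , refl) =
      d k + x , d k + y , trans (inA-shift k x≤d) x∈A , trans (inA-shift k y≤d) y∈A , regroup (d k) x y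
      where
      x≤d : x ≤ d k
      x≤d = ≤-trans (m≤m+n x y) (≤-trans m≤R (R≤d k))
      y≤d : y ≤ d k
      y≤d = ≤-trans (m≤n+m y x) (≤-trans m≤R (R≤d k))
      regroup : ∀ d x y → d + x + (d + y) ≡ d + d + (x + y)
      regroup = solve-∀

  sum-free : ∀ {n} → inA n ≡ true → ¬ IsSum n
  sum-free {n} n∈A = go n (<⇒≤ (k<B n)) n∈A
    where
    go : ∀ k {n} → n ≤ B k → inA n ≡ true → ¬ IsSum n
    go zero    {zero}       _ ()
    go zero    {suc zero}   _ _ (x , y , x∈A , y∈A , x+y≡1) =
      <⇒≱ (s≤s (s≤s z≤n)) (subst (2 ≤_) x+y≡1 (+-mono-≤ (inA⇒0< x x∈A) (inA⇒0< y y∈A)))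
    go zero    {2+ n} (s≤s ()) _
    go (suc k) {n} n≤B n∈A with n ≤? d k
    ... | yes n≤d = go k (inA⇒≤B k n∈A n≤d) n∈A
    ... | no  n≰d with m≤n⇒∃[o]m+o≡n (≰⇒> n≰d)
    ...   | m , refl = go k 1+m≤B 1+m∈A ∘ Equivalence.to (IsSum-shift k (s≤s z≤n) 1+m≤d) ∘ subst IsSum (sym d+[1+m]≡1+d+m)
      where
      d+[1+m]≡1+d+m : d k + suc m ≡ suc (d k + m)
      d+[1+m]≡1+d+m = +-suc (d k) m
      1+m≤B : suc m ≤ B k
      1+m≤B = +-cancelˡ-≤ (d k) _ _ (subst (_≤ B (suc k)) (sym d+[1+m]≡1+d+m) n≤B)
      1+m≤d : suc m ≤ d k
      1+m≤d = ≤-trans 1+m≤B (B≤d k)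
      1+m∈A : inA (suc m) ≡ true
      1+m∈A = trans (sym (inA-shift k 1+m≤d)) (subst (λ z → inA z ≡ true) (sym d+[1+m]≡1+d+m) n∈A)

  -- Cameron's procedure applied to c

  -- The number of letters of c that θ has read after examining 1, …, n.
  nonSums : ℕ → ℕ
  nonSums zero    = 0
  nonSums (suc n) = if does (isSum? (suc n)) then nonSums n else suc (nonSums n)

  nonSums-sum : ∀ {n} → IsSum (suc n) → nonSums (suc n) ≡ nonSums n
  nonSums-sum {n} s rewrite dec-true (isSum? (suc n)) s = refl

  nonSums-nonSum : ∀ {n} → ¬ IsSum (suc n) → nonSums (suc n) ≡ suc (nonSums n)
  nonSums-nonSum {n} ¬s rewrite dec-false (isSum? (suc n)) ¬s = refl

  nonSums-gap : ∀ p m → (∀ i → 0 < i → i ≤ m → ¬ IsSum (p + i)) → nonSums (p + m) ≡ nonSums p + m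
  nonSums-gap p zero    _   = trans (cong nonSums (+-identityʳ p)) (sym (+-identityʳ _))
  nonSums-gap p (suc m) gap = begin
    nonSums (p + suc m)       ≡⟨ cong nonSums (+-suc p m) ⟩
    nonSums (suc (p + m))     ≡⟨ nonSums-nonSum (gap (suc m) (s≤s z≤n) ≤-refl ∘ subst IsSum (sym (+-suc p m))) ⟩
    suc (nonSums (p + m))     ≡⟨ cong suc (nonSums-gap p m (λ i 0<i i≤m → gap i 0<i (m≤n⇒m≤1+n i≤m))) ⟩
    suc (nonSums p + m)       ≡⟨ +-suc (nonSums p) m ⟨
    nonSums p + suc m         ∎
    where open ≡-Reasoning

  nonSums-shift : ∀ p m → (∀ i → 0 < i → i ≤ m → IsSum (p + i) ⇔ IsSum i) → nonSums (p + m) ≡ nonSums p + nonSums m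
  nonSums-shift p zero    _    = trans (cong nonSums (+-identityʳ p)) (sym (+-identityʳ _))
  nonSums-shift p (suc m) same = shifted (isSum? (suc m))
    where
    open ≡-Reasoning
    same′ : IsSum (p + suc m) ⇔ IsSum (suc m)
    same′ = same (suc m) (s≤s z≤n) ≤-refl
    ih : nonSums (p + m) ≡ nonSums p + nonSums m
    ih = nonSums-shift p m (λ i 0<i i≤m → same i 0<i (m≤n⇒m≤1+n i≤m))
    shifted : Dec (IsSum (suc m)) → nonSums (p + suc m) ≡ nonSums p + nonSums (suc m)
    shifted (yes s) = begin
      nonSums (p + suc m)         ≡⟨ cong nonSums (+-suc p m) ⟩
      nonSums (suc (p + m))       ≡⟨ nonSums-sum (subst IsSum (+-suc p m) (Equivalence.from same′ s)) ⟩
      nonSums (p + m)             ≡⟨ ih ⟩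
      nonSums p + nonSums m       ≡⟨ cong (nonSums p +_) (nonSums-sum s) ⟨
      nonSums p + nonSums (suc m) ∎
    shifted (no ¬s) = begin
      nonSums (p + suc m)         ≡⟨ cong nonSums (+-suc p m) ⟩
      nonSums (suc (p + m))       ≡⟨ nonSums-nonSum (¬s ∘ Equivalence.to same′ ∘ subst IsSum (sym (+-suc p m))) ⟩
      suc (nonSums (p + m))       ≡⟨ cong suc ih ⟩
      suc (nonSums p + nonSums m) ≡⟨ +-suc (nonSums p) (nonSums m) ⟨
      nonSums p + suc (nonSums m) ≡⟨ cong (nonSums p +_) (nonSums-nonSum ¬s) ⟨
      nonSums p + nonSums (suc m) ∎

  nonSums≤nonSums[1+n] : ∀ n → nonSums n ≤ nonSums (suc n)
  nonSums≤nonSums[1+n] n with isSum? (suc n)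
  ... | yes s  = ≤-reflexive (sym (nonSums-sum s))
  ... | no  ¬s = subst (nonSums n ≤_) (sym (nonSums-nonSum ¬s)) (n≤1+n _)

  nonSums-mono : ∀ {n n′} → n ≤ n′ → nonSums n ≤ nonSums n′
  nonSums-mono = stepwise⇒mono-≤ nonSums nonSums≤nonSums[1+n]

  nonSums-< : ∀ {n n′} → ¬ IsSum (suc n) → suc n ≤ n′ → nonSums n < nonSums n′
  nonSums-< ¬s 1+n≤n′ = subst (_≤ _) (nonSums-nonSum ¬s) (nonSums-mono 1+n≤n′)

  -- θ examines n + 1 by reading letter number nonSums n of c.  Up to R k this letter is inA (n + 1);
  -- moreover exactly 3ᵏ of 1, …, R k are sums, and c vanishes from the next unread letter up to M k.
  record Agreement (k : ℕ) : Set where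
    field
      nonSums-R : nonSums (R k) + 3 ^ k ≡ R k
      reads-A   : ∀ {n} → suc n ≤ R k → ¬ IsSum (suc n) → c (nonSums n) ≡ inA (suc n)
      c-unread  : ∀ {j} → nonSums (R k) ≤ j → j < M k → c j ≡ false

  agreement-0 : Agreement 0
  agreement-0 = record { nonSums-R = refl ; reads-A = reads-A ; c-unread = c-initial-gap }
    where
    reads-A : ∀ {n} → suc n ≤ R 0 → ¬ IsSum (suc n) → c (nonSums n) ≡ inA (suc n)
    reads-A {zero}  _ _ = refl
    reads-A {suc zero} _ ¬s = ⊥-elim (¬s (1 , 1 , refl , refl , refl))
    reads-A {2+ n} (s≤s (s≤s ())) _

  module Step (k : ℕ) (agreement : Agreement k) where
    open Agreement agreement

    nonSums-above-R : ∀ {i} → R k + i ≤ d k → nonSums (R k + i) ≡ nonSums (R k) + i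
    nonSums-above-R {i} R+i≤d = nonSums-gap (R k) i
      (λ j 0<j j≤i → ¬IsSum-gap k (m<m+n (R k) 0<j) (≤-trans (+-monoʳ-≤ (R k) j≤i) R+i≤d))

    nonSums-d : nonSums (d k) ≡ M k
    nonSums-d with m≤n⇒∃[o]m+o≡n (R≤d k)
    ... | g , R+g≡d = +-cancelʳ-≡ (3 ^ k) _ _ (begin
      nonSums (d k) + 3 ^ k          ≡⟨ cong (λ x → nonSums x + 3 ^ k) R+g≡d ⟨
      nonSums (R k + g) + 3 ^ k      ≡⟨ cong (_+ 3 ^ k) (nonSums-above-R (≤-reflexive R+g≡d)) ⟩
      nonSums (R k) + g + 3 ^ k      ≡⟨ +-comm-right (nonSums (R k)) g (3 ^ k) ⟩
      nonSums (R k) + 3 ^ k + g      ≡⟨ cong (_+ g) nonSums-R ⟩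
      R k + g                        ≡⟨ R+g≡d ⟩
      3 ^ k + M k                    ≡⟨ +-comm (3 ^ k) (M k) ⟩
      M k + 3 ^ k                    ∎)
      where
      open ≡-Reasoning
      +-comm-right : ∀ x y z → x + y + z ≡ x + z + y
      +-comm-right = solve-∀

    nonSums-d+ : ∀ {m} → m ≤ d k → nonSums (d k + m) ≡ M k + nonSums m
    nonSums-d+ {m} m≤d = trans (nonSums-shift (d k) m (λ i 0<i i≤m → IsSum-shift k 0<i (≤-trans i≤m m≤d)))
                               (cong (_+ nonSums m) nonSums-d)

    R[1+k]≡d+d+R : R (suc k) ≡ d k + d k + R k
    R[1+k]≡d+d+R = shuffle (d k) (B k)
      where
      shuffle : ∀ x y → x + y + (x + y) ≡ x + x + (y + y)
      shuffle = solve-∀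

    nonSums-d+d : nonSums (d k + d k) ≡ M k + M k
    nonSums-d+d = trans (nonSums-d+ ≤-refl) (cong (M k +_) nonSums-d)

    nonSums-2d+ : ∀ {m} → m ≤ R k → nonSums (d k + d k + m) ≡ M k + M k + nonSums m
    nonSums-2d+ {m} m≤R = trans (nonSums-shift (d k + d k) m (λ i 0<i i≤m → IsSum-shift₂ k 0<i (≤-trans i≤m m≤R)))
                                (cong (_+ nonSums m) nonSums-d+d)

    nonSums-R[1+k] : nonSums (R (suc k)) ≡ M k + M k + nonSums (R k)
    nonSums-R[1+k] = trans (cong nonSums R[1+k]≡d+d+R) (nonSums-2d+ ≤-refl)

    nonSums-R[1+k]-sums : nonSums (R (suc k)) + 3 ^ suc k ≡ R (suc k)
    nonSums-R[1+k]-sums = begin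
      nonSums (R (suc k)) + 3 ^ suc k               ≡⟨ cong (_+ 3 ^ suc k) nonSums-R[1+k] ⟩
      M k + M k + nonSums (R k) + 3 * 3 ^ k         ≡⟨ regroup (M k) (nonSums (R k)) (3 ^ k) ⟩
      d k + d k + (nonSums (R k) + 3 ^ k)           ≡⟨ cong (d k + d k +_) nonSums-R ⟩
      d k + d k + R k                               ≡⟨ R[1+k]≡d+d+R ⟨
      R (suc k)                                     ∎
      where
      open ≡-Reasoning
      regroup : ∀ m n x → m + m + n + 3 * x ≡ (x + m) + (x + m) + (n + x)
      regroup = solve-∀

    M+M≤nonSums : ∀ {n} → d k + d k ≤ n → M k + M k ≤ nonSums n
    M+M≤nonSums d+d≤n = subst (_≤ _) nonSums-d+d (nonSums-mono d+d≤n)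

    c-unread[1+k] : ∀ {j} → nonSums (R (suc k)) ≤ j → j < M (suc k) → c j ≡ false
    c-unread[1+k] ≤j = c-gap k (≤-trans (M+M≤nonSums (subst (d k + d k ≤_) (sym R[1+k]≡d+d+R) (m≤m+n _ (R k)))) ≤j)

    reads-A-d : ∀ {n} → suc n ≤ d k → ¬ IsSum (suc n) → c (nonSums n) ≡ inA (suc n)
    reads-A-d {n} 1+n≤d ¬s with suc n ≤? R k
    ... | yes 1+n≤R = reads-A 1+n≤R ¬s
    ... | no  1+n≰R = trans (c-unread (nonSums-mono R≤n) (subst (nonSums n <_) nonSums-d (nonSums-< ¬s 1+n≤d)))
                            (sym (inA-gap k (≤-trans (B<R k) (≤-trans R≤n (n≤1+n n))) 1+n≤d))
      where
      R≤n : R k ≤ n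
      R≤n = ≤-pred (≰⇒> 1+n≰R)

    nonSums-R[1+k]≤M : nonSums (R (suc k)) ≤ M (suc k)
    nonSums-R[1+k]≤M = +-cancelʳ-≤ (3 ^ suc k) _ _
      (subst₂ _≤_ (sym nonSums-R[1+k]-sums) (+-comm (3 ^ suc k) (M (suc k))) (R≤d (suc k)))

    reads-A[1+k] : ∀ {n} → suc n ≤ R (suc k) → ¬ IsSum (suc n) → c (nonSums n) ≡ inA (suc n)
    reads-A[1+k] {n} 1+n≤R ¬s with suc n ≤? d k
    ... | yes 1+n≤d = reads-A-d 1+n≤d ¬s
    ... | no  1+n≰d with m≤n⇒∃[o]m+o≡n (≤-pred (≰⇒> 1+n≰d))
    ...   | m , refl with suc m ≤? d k
    ...     | yes 1+m≤d = begin
      c (nonSums (d k + m))  ≡⟨ cong c (nonSums-d+ (≤-trans (n≤1+n m) 1+m≤d)) ⟩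
      c (M k + nonSums m)    ≡⟨ c-periodic k (subst (nonSums m <_) nonSums-d (nonSums-< ¬s′ 1+m≤d)) ⟩
      c (nonSums m)          ≡⟨ reads-A-d 1+m≤d ¬s′ ⟩
      inA (suc m)            ≡⟨ inA-shift k 1+m≤d ⟨
      inA (d k + suc m)      ≡⟨ cong inA (+-suc (d k) m) ⟩
      inA (suc (d k + m))    ∎
      where
      open ≡-Reasoning
      ¬s′ : ¬ IsSum (suc m)
      ¬s′ = ¬s ∘ subst IsSum (+-suc (d k) m) ∘ Equivalence.from (IsSum-shift k (s≤s z≤n) 1+m≤d)
    ...     | no  1+m≰d = trans (c-gap k (M+M≤nonSums (+-monoʳ-≤ (d k) d≤m)) (≤-trans (nonSums-< ¬s 1+n≤R) nonSums-R[1+k]≤M))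
                                (sym (inA-gap (suc k) B<1+n (≤-trans 1+n≤R (R≤d (suc k)))))
      where
      d≤m : d k ≤ m
      d≤m = ≤-pred (≰⇒> 1+m≰d)
      B<1+n : B (suc k) < suc (d k + m)
      B<1+n = s≤s (+-monoʳ-≤ (d k) (≤-trans (B≤d k) d≤m))

  agreement-suc : ∀ k → Agreement k → Agreement (suc k)
  agreement-suc k agreement = record
    { nonSums-R = nonSums-R[1+k]-sums ; reads-A = reads-A[1+k] ; c-unread = c-unread[1+k] }
    where open Step k agreement

  agreement : ∀ k → Agreement k
  agreement zero    = agreement-0
  agreement (suc k) = agreement-suc k (agreement k)

  c-reads-A : ∀ {n} → ¬ IsSum (suc n) → c (nonSums n) ≡ inA (suc n)
  c-reads-A {n} = Agreement.reads-A (agreement n) (≤-trans (k<B n) (m≤m+n (B n) (B n)))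

  Represents : List ℕ → ℕ → Set
  Represents L n = ∀ x → x ∈ᵇ L ≡ (inA x ∧ (x ≤ᵇ n))

  represents⇒inA : ∀ {L n} → Represents L n → ∀ x → x ∈ᵇ L ≡ true → inA x ≡ true × x ≤ n
  represents⇒inA {L} {n} rep x x∈L with ∧≡true⇒ {inA x} (trans (sym (rep x)) x∈L)
  ... | x∈A , x≤ᵇn = x∈A , ≤ᵇ⇒≤ x n (subst T (sym x≤ᵇn) _)

  summand : List ℕ → ℕ → ℕ → Bool
  summand L m x = if x ≤ᵇ m then (m ∸ x) ∈ᵇ L else false

  isSum-sound : ∀ {L n} → Represents L n → isSum L (suc n) ≡ true → IsSum (suc n)
  isSum-sound {L} {n} rep eq with any-∈ᵇ⁻ (summand L (suc n)) L eq
  ... | x , x∈L , summand-x with x ≤ᵇ suc n in x≤ᵇ1+n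
  ...   | true = x , suc n ∸ x , proj₁ (represents⇒inA {L} rep x x∈L) ,
                 proj₁ (represents⇒inA {L} rep (suc n ∸ x) summand-x) ,
                 m+[n∸m]≡n (≤ᵇ⇒≤ x (suc n) (subst T (sym x≤ᵇ1+n) _))
  isSum-sound rep eq | x , x∈L , () | false

  isSum-complete : ∀ {L n} → Represents L n → IsSum (suc n) → isSum L (suc n) ≡ true
  isSum-complete {L} {n} rep (x , y , x∈A , y∈A , x+y≡1+n) = any-∈ᵇ⁺ (summand L (suc n)) L {x} x∈L summand-x
    where
    x≤n : x ≤ n
    x≤n = ≤-pred (subst (x <_) x+y≡1+n (m<m+n x (inA⇒0< y y∈A)))
    y≤n : y ≤ n
    y≤n = ≤-pred (subst (y <_) x+y≡1+n (m<n+m y (inA⇒0< x x∈A)))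
    in-L : ∀ {z} → inA z ≡ true → z ≤ n → z ∈ᵇ L ≡ true
    in-L {z} z∈A z≤ = trans (rep z) (cong₂ _∧_ z∈A (dec-true (z ≤? n) z≤))
    x∈L : x ∈ᵇ L ≡ true
    x∈L = in-L x∈A x≤n
    summand-x : summand L (suc n) x ≡ true
    summand-x rewrite dec-true (x ≤? suc n) (m≤n⇒m≤1+n x≤n) | sym x+y≡1+n | m+n∸m≡n x y = in-L y∈A y≤n

  isSum-false⇒¬IsSum : ∀ {L n} → Represents L n → isSum L (suc n) ≡ false → ¬ IsSum (suc n)
  isSum-false⇒¬IsSum {L} rep isSum-L s with () ← trans (sym isSum-L) (isSum-complete {L} rep s)

  ≤ᵇ-step : ∀ {x n} → x ≢ suc n → (x ≤ᵇ n) ≡ (x ≤ᵇ suc n)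
  ≤ᵇ-step {x} {n} x≢1+n = ≡true⇔⇒≡does (x ≤? suc n)
    (λ x≤ᵇn → m≤n⇒m≤1+n (≤ᵇ⇒≤ x n (subst T (sym x≤ᵇn) _)))
    (λ x≤1+n → dec-true (x ≤? n) (≤-pred (≤∧≢⇒< x≤1+n x≢1+n)))

  represents-skip : ∀ {L n} → Represents L n → inA (suc n) ≡ false → Represents L (suc n)
  represents-skip {L} {n} rep 1+n∉A x with x ≟ suc n
  ... | yes refl rewrite rep (suc n) | 1+n∉A = refl
  ... | no  x≢1+n rewrite rep x | ≤ᵇ-step x≢1+n = refl

  represents-add : ∀ {L n} → Represents L n → inA (suc n) ≡ true → Represents (suc n ∷ L) (suc n)
  represents-add {L} {n} rep 1+n∈A x with x ≟ suc n
  ... | yes refl rewrite dec-true (suc n ≟ suc n) refl | 1+n∈A | dec-true (suc n ≤? suc n) ≤-refl = refl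
  ... | no  x≢1+n rewrite dec-false (x ≟ suc n) x≢1+n | rep x | ≤ᵇ-step x≢1+n = refl

  sum⇒∉A : ∀ {m} → IsSum m → inA m ≡ false
  sum⇒∉A {m} s with inA m in m∈A
  ... | false = refl
  ... | true  = ⊥-elim (sum-free m∈A s)

  θState-invariant : ∀ n → Represents (proj₁ (θState c n)) n × proj₂ (θState c n) ≡ nonSums n
  θState-invariant zero = (λ { zero → refl ; (suc x) → sym (∧-zeroʳ _) }) , refl
  θState-invariant (suc n) with θState c n | θState-invariant n
  ... | L , k | rep , refl with isSum L (suc n) in isSum-L
  ...   | true = represents-skip {L} rep (sum⇒∉A s) , sym (nonSums-sum {n} s)
    where
    s : IsSum (suc n)
    s = isSum-sound {L} rep isSum-L
  ...   | false with c (nonSums n) in read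
  ...     | true  = represents-add {L} rep (trans (sym (c-reads-A ¬s)) read) , sym (nonSums-nonSum {n} ¬s)
    where
    ¬s : ¬ IsSum (suc n)
    ¬s = isSum-false⇒¬IsSum {L} rep isSum-L
  ...     | false = represents-skip {L} rep (trans (sym (c-reads-A ¬s)) read) , sym (nonSums-nonSum {n} ¬s)
    where
    ¬s : ¬ IsSum (suc n)
    ¬s = isSum-false⇒¬IsSum {L} rep isSum-L

  inθ≡inA : ∀ m → inθ c m ≡ inA m
  inθ≡inA m = trans (proj₁ (θState-invariant m) m) (trans (cong (inA m ∧_) (dec-true (m ≤? m) ≤-refl)) (∧-identityʳ _))

open import Data.Integer using (ℤ; +_; -_) renaming (_+_ to _+ℤ_; _*_ to _*ℤ_)
import Data.Integer.Properties as ℤ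
import Data.Integer.Tactic.RingSolver as ℤ-Solver
open import Data.Fin using (Fin; zero; suc)
open import Data.Vec using (_∷_; []; lookup)

Span : ∀ {r} → (Fin r → ℕ → ℤ) → (ℕ → ℤ) → Set
Span {r} g f = Σ (Fin r → ℤ) λ a → ∀ n → f n ≡ finSum r (λ j → a j *ℤ g j n)

finSum-+ : ∀ r (u v : Fin r → ℤ) → finSum r (λ j → u j +ℤ v j) ≡ finSum r u +ℤ finSum r v
finSum-+ zero    u v = refl
finSum-+ (suc r) u v =
  trans (cong ((u zero +ℤ v zero) +ℤ_) (finSum-+ r (u ∘ suc) (v ∘ suc)))
        (interchange (u zero) (v zero) (finSum r (u ∘ suc)) (finSum r (v ∘ suc)))
  where
  interchange : ∀ a b x y → (a +ℤ b) +ℤ (x +ℤ y) ≡ (a +ℤ x) +ℤ (b +ℤ y)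
  interchange = ℤ-Solver.solve-∀

finSum-scale : ∀ r k (u : Fin r → ℤ) → finSum r (λ j → k *ℤ u j) ≡ k *ℤ finSum r u
finSum-scale zero    k u = sym (ℤ.*-zeroʳ k)
finSum-scale (suc r) k u = trans (cong (k *ℤ u zero +ℤ_) (finSum-scale r k (u ∘ suc))) (sym (ℤ.*-distribˡ-+ k _ _))

finSum-zero : ∀ r → finSum r (λ _ → + 0) ≡ + 0
finSum-zero zero    = refl
finSum-zero (suc r) = trans (ℤ.+-identityˡ _) (finSum-zero r)

finSum-cong : ∀ r {u v : Fin r → ℤ} → (∀ j → u j ≡ v j) → finSum r u ≡ finSum r v
finSum-cong zero    _   = refl
finSum-cong (suc r) u≗v = cong₂ _+ℤ_ (u≗v zero) (finSum-cong r (u≗v ∘ suc))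

δ : ∀ {r} → Fin r → Fin r → ℤ
δ zero    zero    = + 1
δ zero    (suc _) = + 0
δ (suc _) zero    = + 0
δ (suc i) (suc j) = δ i j

finSum-δ : ∀ r (i : Fin r) (x : Fin r → ℤ) → finSum r (λ j → δ i j *ℤ x j) ≡ x i
finSum-δ (suc r) zero    x = trans (cong (+ 1 *ℤ x zero +ℤ_)
                                 (trans (finSum-cong r (λ j → ℤ.*-zeroˡ (x (suc j)))) (finSum-zero r)))
                               (trans (ℤ.+-identityʳ _) (ℤ.*-identityˡ (x zero)))
finSum-δ (suc r) (suc i) x =
  trans (cong (_+ℤ finSum r (λ j → δ i j *ℤ x (suc j))) (ℤ.*-zeroˡ (x zero)))
        (trans (ℤ.+-identityˡ _) (finSum-δ r i (x ∘ suc)))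

module _ {r} (g : Fin r → ℕ → ℤ) where

  span-gen : ∀ j → Span g (g j)
  span-gen j = δ j , λ n → sym (finSum-δ r j (λ i → g i n))

  span-zero : Span g (λ _ → + 0)
  span-zero = (λ _ → + 0) , λ n → sym (trans (finSum-cong r (λ j → ℤ.*-zeroˡ (g j n))) (finSum-zero r))

  span-+ : ∀ {u v} → Span g u → Span g v → Span g (λ n → u n +ℤ v n)
  span-+ (a , u≡) (b , v≡) = (λ j → a j +ℤ b j) , λ n →
    trans (cong₂ _+ℤ_ (u≡ n) (v≡ n))
          (trans (sym (finSum-+ r _ _)) (finSum-cong r (λ j → sym (ℤ.*-distribʳ-+ (g j n) (a j) (b j)))))

  span-scale : ∀ k {u} → Span g u → Span g (λ n → k *ℤ u n)
  span-scale k (a , u≡) = (λ j → k *ℤ a j) , λ n →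
    trans (cong (k *ℤ_) (u≡ n)) (trans (sym (finSum-scale r k _)) (finSum-cong r (λ j → sym (ℤ.*-assoc k (a j) (g j n)))))

  span-≗ : ∀ {u v} → (∀ n → v n ≡ u n) → Span g u → Span g v
  span-≗ v≗u (a , u≡) = a , λ n → trans (v≗u n) (u≡ n)

  span-finSum : ∀ s (c : Fin s → ℤ) (h : Fin s → ℕ → ℤ) → (∀ j → Span g (h j)) →
                Span g (λ n → finSum s (λ j → c j *ℤ h j n))
  span-finSum zero    c h _      = span-zero
  span-finSum (suc s) c h h∈span =
    span-+ (span-scale (c zero) (h∈span zero)) (span-finSum s (c ∘ suc) (h ∘ suc) (h∈span ∘ suc))

  span-recurrence : ∀ (u : ℕ → ℕ → ℤ) α β γ {v} → Span g v →
    (∀ i n → u (3 + i) n ≡ α *ℤ u (2 + i) n +ℤ β *ℤ u (1 + i) n +ℤ γ *ℤ u i n +ℤ v n) →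
    Span g (u 0) → Span g (u 1) → Span g (u 2) → ∀ i → Span g (u i)
  span-recurrence u α β γ v∈span rec u₀ u₁ u₂ i = proj₁ (three i)
    where
    three : ∀ i → Span g (u i) × Span g (u (suc i)) × Span g (u (suc (suc i)))
    three zero = u₀ , u₁ , u₂
    three (suc i) with three i
    ... | uᵢ , uᵢ₊₁ , uᵢ₊₂ = uᵢ₊₁ , uᵢ₊₂ ,
      span-≗ (rec i) (span-+ (span-+ (span-+ (span-scale α uᵢ₊₂) (span-scale β uᵢ₊₁)) (span-scale γ uᵢ)) v∈span)

  span-digitSumWith : ∀ f (w : ℕ → ℕ) → (∀ j → Span g (λ _ → + w j)) → ∀ b → Span g (λ _ → + digitSumWith f w b)
  span-digitSumWith zero    w _      b = span-zero
  span-digitSumWith (suc f) w w∈span b = span-≗ split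
    (span-+ (span-scale (+ bit b) (w∈span 0)) (span-digitSumWith f (w ∘ suc) (w∈span ∘ suc) ⌊ b /2⌋))
    where
    split : ∀ n → + (bit b * w 0 + digitSumWith f (w ∘ suc) ⌊ b /2⌋)
                  ≡ + bit b *ℤ + w 0 +ℤ + digitSumWith f (w ∘ suc) ⌊ b /2⌋
    split _ = trans (ℤ.pos-+ (bit b * w 0) _) (cong (_+ℤ + digitSumWith f (w ∘ suc) ⌊ b /2⌋) (ℤ.pos-* (bit b) (w 0)))

inSpan-single : ∀ {P : (ℕ → ℤ) → Set} {f} → P f → InSpan P f
inSpan-single {f = f} Pf =
  1 , (λ _ → + 1) , (λ _ → f) , (λ _ → Pf) , λ n → sym (trans (ℤ.+-identityʳ _) (ℤ.*-identityˡ (f n)))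

inSpan-difference : ∀ {P : (ℕ → ℤ) → Set} {u v f} → P u → P v → (∀ n → f n ≡ u n +ℤ - v n) → InSpan P f
inSpan-difference {P} {u} {v} Pu Pv f≡ = 2 , coefficient , vector , membership , λ n → trans (f≡ n) (rescale (u n) (v n))
  where
  coefficient : Fin 2 → ℤ
  coefficient zero       = + 1
  coefficient (suc zero) = - + 1
  vector : Fin 2 → ℕ → ℤ
  vector zero       = u
  vector (suc zero) = v
  membership : ∀ j → P (vector j)
  membership zero       = Pu
  membership (suc zero) = Pv
  rescale : ∀ x y → x +ℤ - y ≡ + 1 *ℤ x +ℤ (- + 1 *ℤ y +ℤ + 0)
  rescale = ℤ-Solver.solve-∀

ℕ-recurrence⇒ℤ : ∀ e f h {a₃ a₂ a₁ a₀} → a₃ + e * a₁ ≡ f * a₂ + h * a₀ →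
                 + a₃ ≡ + f *ℤ + a₂ +ℤ - + e *ℤ + a₁ +ℤ + h *ℤ + a₀
ℕ-recurrence⇒ℤ e f h {a₃} {a₂} {a₁} {a₀} eq = solve-for-a₃ (+ a₃) (+ a₂) (+ a₁) (+ a₀) (+ e) (+ f) (+ h) (begin
  + a₃ +ℤ + e *ℤ + a₁         ≡⟨ cong (+ a₃ +ℤ_) (ℤ.pos-* e a₁) ⟨
  + a₃ +ℤ + (e * a₁)         ≡⟨ ℤ.pos-+ a₃ (e * a₁) ⟨
  + (a₃ + e * a₁)           ≡⟨ cong +_ eq ⟩
  + (f * a₂ + h * a₀)      ≡⟨ ℤ.pos-+ (f * a₂) (h * a₀) ⟩
  + (f * a₂) +ℤ + (h * a₀)  ≡⟨ cong₂ _+ℤ_ (ℤ.pos-* f a₂) (ℤ.pos-* h a₀) ⟩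
  + f *ℤ + a₂ +ℤ + h *ℤ + a₀  ∎)
  where
  open ≡-Reasoning
  solve-for-a₃ : ∀ x₃ x₂ x₁ x₀ e f h → x₃ +ℤ e *ℤ x₁ ≡ f *ℤ x₂ +ℤ h *ℤ x₀ →
                 x₃ ≡ f *ℤ x₂ +ℤ - e *ℤ x₁ +ℤ h *ℤ x₀
  solve-for-a₃ x₃ x₂ x₁ x₀ e f h eq = begin
    x₃                                        ≡⟨ isolate x₃ (e *ℤ x₁) ⟩
    (x₃ +ℤ e *ℤ x₁) +ℤ - (e *ℤ x₁)            ≡⟨ cong (_+ℤ - (e *ℤ x₁)) eq ⟩
    (f *ℤ x₂ +ℤ h *ℤ x₀) +ℤ - (e *ℤ x₁)       ≡⟨ regroup f x₂ h x₀ e x₁ ⟩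
    f *ℤ x₂ +ℤ - e *ℤ x₁ +ℤ h *ℤ x₀           ∎
    where
    isolate : ∀ x y → x ≡ (x +ℤ y) +ℤ - y
    isolate = ℤ-Solver.solve-∀
    regroup : ∀ f x h y e z → (f *ℤ x +ℤ h *ℤ y) +ℤ - (e *ℤ z) ≡ f *ℤ x +ℤ - e *ℤ z +ℤ h *ℤ y
    regroup = ℤ-Solver.solve-∀

ℕ-difference⇒ℤ : ∀ {a b c} → a ≡ c + b → + c ≡ + a +ℤ - + b
ℕ-difference⇒ℤ {a} {b} {c} refl = trans (cancel (+ c) (+ b)) (cong (_+ℤ - + b) (sym (ℤ.pos-+ c b)))
  where
  cancel : ∀ x y → x ≡ x +ℤ y +ℤ - y
  cancel = ℤ-Solver.solve-∀

twoRegular-intro : ∀ {r} (t : ℕ → ℤ) (g : Fin r → ℕ → ℤ) →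
  (∀ j → InSpan (In2Kernel t) (g j)) → (∀ f → In2Kernel t f → Span g f) → TwoRegular t
twoRegular-intro {r} t g g∈span kernel⊆span = r , g , g∈span , λ where
  f (s , c , h , h∈kernel , f≡) → span-≗ g f≡ (span-finSum g s c h (λ j → kernel⊆span (h j) (h∈kernel j)))

-- 2-regularity

module Regularity (l₁ l₂ l₃ : ℕ) (3≤l₃ : 3 ≤ l₃) (1≤l₁+l₂ : 1 ≤ l₁ + l₂) where
  open Cantor l₁ l₂ l₃ 3≤l₃ 1≤l₁+l₂

  -- d k is a combination of 2ᵏ, 3ᵏ and l₃ᵏ, so it satisfies the recurrence with characteristic
  -- polynomial (x - 2)(x - 3)(x - l₃) = x³ - F x² + E x - H.
  E F H : ℕ
  E = 6 + 5 * l₃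
  F = 5 + l₃
  H = 6 * l₃

  d-recurrence : ∀ k → d (3 + k) + E * d (1 + k) ≡ F * d (2 + k) + H * d k
  d-recurrence k = identity (3 ^ k) (l₃ ^ k) (L k) l₁ l₂ l₃
    where
    identity : ∀ X Y L p q t →
      let L₁ = 2 * L + (p + q) * Y
          L₂ = 2 * L₁ + (p + q) * (t * Y)
          L₃ = 2 * L₂ + (p + q) * (t * (t * Y))
      in (3 * (3 * (3 * X)) + (L₃ + p * (t * (t * (t * Y))))) + (6 + 5 * t) * (3 * X + (L₁ + p * (t * Y)))
         ≡ (5 + t) * (3 * (3 * X) + (L₂ + p * (t * (t * Y)))) + 6 * t * (X + (L + p * Y))
    identity = solve-∀

  G-recurrence : ∀ i n → G (3 + i) n + E * G (1 + i) n ≡ F * G (2 + i) n + H * G i n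
  G-recurrence i n = begin
    G (3 + i) n + E * G (1 + i) n
      ≡⟨ cong (_+_ (G (3 + i) n)) (digitSumWith-scale n E (λ j → d (1 + i + j)) n) ⟨
    digitSum (λ j → d (3 + i + j)) n + digitSum (λ j → E * d (1 + i + j)) n
      ≡⟨ digitSumWith-+ n (λ j → d (3 + i + j)) (λ j → E * d (1 + i + j)) n ⟨
    digitSum (λ j → d (3 + i + j) + E * d (1 + i + j)) n
      ≡⟨ digitSumWith-cong n n (λ j → d-recurrence (i + j)) ⟩
    digitSum (λ j → F * d (2 + i + j) + H * d (i + j)) n
      ≡⟨ digitSumWith-+ n (λ j → F * d (2 + i + j)) (λ j → H * d (i + j)) n ⟩
    digitSum (λ j → F * d (2 + i + j)) n + digitSum (λ j → H * d (i + j)) n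
      ≡⟨ cong₂ _+_ (digitSumWith-scale n F (λ j → d (2 + i + j)) n) (digitSumWith-scale n H (λ j → d (i + j)) n) ⟩
    F * G (2 + i) n + H * G i n ∎
    where open ≡-Reasoning

  h : ℕ → ℕ → ℤ
  h i n = + S (2 ^ i * n + 0)

  h≡1+G : ∀ i n → h i n ≡ + 1 +ℤ + G i n
  h≡1+G i n = trans (cong +_ (S-split i n (m^n>0 2 i))) (ℤ.pos-+ 1 (G i n))

  combination : ℤ → ℤ → ℤ → ℤ
  combination x₂ x₁ x₀ = + F *ℤ x₂ +ℤ - + E *ℤ x₁ +ℤ + H *ℤ x₀

  combination-cong : ∀ {x₂ x₁ x₀ y₂ y₁ y₀} → x₂ ≡ y₂ → x₁ ≡ y₁ → x₀ ≡ y₀ →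
                     combination x₂ x₁ x₀ ≡ combination y₂ y₁ y₀
  combination-cong refl refl refl = refl

  -- The inhomogeneity produced by the constant 1 in h i n = 1 + G i n.
  κ : ℤ
  κ = + 1 +ℤ - + F +ℤ + E +ℤ - + H

  h-recurrence : ∀ i n → h (3 + i) n ≡ combination (h (2 + i) n) (h (1 + i) n) (h i n) +ℤ κ
  h-recurrence i n = begin
    h (3 + i) n
      ≡⟨ h≡1+G (3 + i) n ⟩
    + 1 +ℤ + G (3 + i) n
      ≡⟨ cong (+ 1 +ℤ_) (ℕ-recurrence⇒ℤ E F H {G (3 + i) n} {G (2 + i) n} {G (1 + i) n} {G i n} (G-recurrence i n)) ⟩
    + 1 +ℤ combination (+ G (2 + i) n) (+ G (1 + i) n) (+ G i n)
      ≡⟨ identity (+ F) (+ E) (+ H) (+ G (2 + i) n) (+ G (1 + i) n) (+ G i n) ⟩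
    combination (+ 1 +ℤ + G (2 + i) n) (+ 1 +ℤ + G (1 + i) n) (+ 1 +ℤ + G i n) +ℤ κ
      ≡⟨ cong (_+ℤ κ) (combination-cong (h≡1+G (2 + i) n) (h≡1+G (1 + i) n) (h≡1+G i n)) ⟨
    combination (h (2 + i) n) (h (1 + i) n) (h i n) +ℤ κ ∎
    where
    open ≡-Reasoning
    identity : ∀ f e h x₂ x₁ x₀ → + 1 +ℤ (f *ℤ x₂ +ℤ - e *ℤ x₁ +ℤ h *ℤ x₀)
      ≡ f *ℤ (+ 1 +ℤ x₂) +ℤ - e *ℤ (+ 1 +ℤ x₁) +ℤ h *ℤ (+ 1 +ℤ x₀) +ℤ (+ 1 +ℤ - f +ℤ e +ℤ - h)
    identity = ℤ-Solver.solve-∀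

  generators : Fin 7 → ℕ → ℤ
  generators = lookup (h 0 ∷ h 1 ∷ h 2 ∷ h 3 ∷ (λ _ → + d 0) ∷ (λ _ → + d 1) ∷ (λ _ → + d 2) ∷ [])

  span-combination : ∀ {u₂ u₁ u₀} → Span generators u₂ → Span generators u₁ → Span generators u₀ →
                     Span generators (λ n → combination (u₂ n) (u₁ n) (u₀ n))
  span-combination u₂ u₁ u₀ =
    span-+ generators (span-+ generators (span-scale generators (+ F) u₂) (span-scale generators (- + E) u₁))
                      (span-scale generators (+ H) u₀)

  span-κ : Span generators (λ _ → κ)
  span-κ = span-≗ generators κ≡
    (span-+ generators (span-gen generators (suc (suc (suc zero))))
                       (span-scale generators (- + 1) (span-combination (span-gen generators (suc (suc zero)))
                                                                        (span-gen generators (suc zero))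
                                                                        (span-gen generators zero))))
    where
    κ≡ : ∀ n → κ ≡ h 3 n +ℤ - + 1 *ℤ combination (h 2 n) (h 1 n) (h 0 n)
    κ≡ n = trans (cancel (combination (h 2 n) (h 1 n) (h 0 n)) κ)
                 (cong (_+ℤ - + 1 *ℤ combination (h 2 n) (h 1 n) (h 0 n)) (sym (h-recurrence 0 n)))
      where
      cancel : ∀ x k → k ≡ x +ℤ k +ℤ - + 1 *ℤ x
      cancel = ℤ-Solver.solve-∀

  span-h : ∀ i → Span generators (h i)
  span-h = span-recurrence generators h (+ F) (- + E) (+ H) span-κ h-recurrence
    (span-gen generators zero) (span-gen generators (suc zero)) (span-gen generators (suc (suc zero)))

  span-d : ∀ j → Span generators (λ _ → + d j)
  span-d = span-recurrence generators (λ j _ → + d j) (+ F) (- + E) (+ H) (span-zero generators)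
    (λ j _ → trans (ℕ-recurrence⇒ℤ E F H {d (3 + j)} {d (2 + j)} {d (1 + j)} {d j} (d-recurrence j)) (sym (ℤ.+-identityʳ _)))
    (span-gen generators (suc (suc (suc (suc zero)))))
    (span-gen generators (suc (suc (suc (suc (suc zero))))))
    (span-gen generators (suc (suc (suc (suc (suc (suc zero)))))))

  kernel⊆span : ∀ f → In2Kernel (λ n → + S n) f → Span generators f
  kernel⊆span f (i , b , b<2^i , f≡) =
    span-≗ generators f≡h+const (span-+ generators (span-h i) (span-digitSumWith generators b d span-d b))
    where
    f≡h+const : ∀ n → f n ≡ h i n +ℤ + digitSum d b
    f≡h+const n = begin
      f n                                 ≡⟨ f≡ n ⟩
      + S (2 ^ i * n + b)                 ≡⟨ cong +_ (S-split i n b<2^i) ⟩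
      + suc (digitSum d b + G i n)        ≡⟨ cong (+_ ∘ suc) (+-comm (digitSum d b) (G i n)) ⟩
      + (suc (G i n) + digitSum d b)      ≡⟨ ℤ.pos-+ (suc (G i n)) (digitSum d b) ⟩
      + suc (G i n) +ℤ + digitSum d b     ≡⟨ cong (λ x → + x +ℤ + digitSum d b) (S-split i n (m^n>0 2 i)) ⟨
      h i n +ℤ + digitSum d b             ∎
      where open ≡-Reasoning

  d-in-kernel-span : ∀ j → InSpan (In2Kernel (λ n → + S n)) (λ _ → + d j)
  d-in-kernel-span j = inSpan-difference {P = In2Kernel (λ n → + S n)}
    {u = λ n → + S (2 ^ suc j * n + 2 ^ j)} {v = λ n → + S (2 ^ suc j * n + 0)}
    (suc j , 2 ^ j , 2^j<2^[1+j] , λ _ → refl) (suc j , 0 , m^n>0 2 (suc j) , λ _ → refl)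
    (λ n → ℕ-difference⇒ℤ (S-top-bit n))
    where
    2^j<2^[1+j] : 2 ^ j < 2 ^ suc j
    2^j<2^[1+j] = m<m+n (2 ^ j) (subst (0 <_) (sym (+-identityʳ (2 ^ j))) (m^n>0 2 j))
    S-top-bit : ∀ n → S (2 ^ suc j * n + 2 ^ j) ≡ d j + S (2 ^ suc j * n + 0)
    S-top-bit n = begin
      S (2 ^ suc j * n + 2 ^ j)        ≡⟨ S-split (suc j) n 2^j<2^[1+j] ⟩
      S (2 ^ j) + G (suc j) n          ≡⟨ cong (λ x → S x + G (suc j) n) (+-identityʳ (2 ^ j)) ⟨
      S (2 ^ j + 0) + G (suc j) n      ≡⟨ cong (_+ G (suc j) n) (S-shift j (m^n>0 2 j)) ⟩
      d j + 1 + G (suc j) n            ≡⟨ +-assoc (d j) 1 (G (suc j) n) ⟩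
      d j + suc (G (suc j) n)          ≡⟨ cong (_+_ (d j)) (S-split (suc j) n (m^n>0 2 (suc j))) ⟨
      d j + S (2 ^ suc j * n + 0)      ∎
      where open ≡-Reasoning

  h-in-kernel-span : ∀ i → InSpan (In2Kernel (λ n → + S n)) (h i)
  h-in-kernel-span i = inSpan-single {P = In2Kernel (λ n → + S n)} (i , 0 , m^n>0 2 i , λ _ → refl)

  generators-in-kernel-span : ∀ j → InSpan (In2Kernel (λ n → + S n)) (generators j)
  generators-in-kernel-span zero                                   = h-in-kernel-span 0
  generators-in-kernel-span (suc zero)                             = h-in-kernel-span 1
  generators-in-kernel-span (suc (suc zero))                       = h-in-kernel-span 2
  generators-in-kernel-span (suc (suc (suc zero)))                 = h-in-kernel-span 3
  generators-in-kernel-span (suc (suc (suc (suc zero))))           = d-in-kernel-span 0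
  generators-in-kernel-span (suc (suc (suc (suc (suc zero)))))     = d-in-kernel-span 1
  generators-in-kernel-span (suc (suc (suc (suc (suc (suc zero)))))) = d-in-kernel-span 2

  S-twoRegular : TwoRegular (λ n → + S n)
  S-twoRegular = twoRegular-intro (λ n → + S n) generators generators-in-kernel-span kernel⊆span

l₁[l₃∸1]+l₂>3⇒l₁+l₂>0 : ∀ l₁ l₂ l₃ → 3 < l₁ * (l₃ ∸ 1) + l₂ → 1 ≤ l₁ + l₂
l₁[l₃∸1]+l₂>3⇒l₁+l₂>0 zero    zero    l₃ ()
l₁[l₃∸1]+l₂>3⇒l₁+l₂>0 zero    (suc _) l₃ _ = s≤s z≤n
l₁[l₃∸1]+l₂>3⇒l₁+l₂>0 (suc _) _       l₃ _ = s≤s z≤n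

mainTheorem7 : (l₁ l₂ l₃ : ℕ) → 3 ≤ l₃ → 4 * (l₁ + l₂) + 17 ≤ 7 * l₃ → 3 < l₁ * (l₃ ∸ 1) + l₂ →
    Σ (ℕ → ℕ) λ S →
      (∀ n → S n < S (1 + n)) ×
      (∀ m → inθ (cantor l₁ l₂ l₃) m ≡ true → Σ ℕ λ n → S n ≡ m) ×
      (∀ n → inθ (cantor l₁ l₂ l₃) (S n) ≡ true) ×
      TwoRegular (λ n → + S n)
mainTheorem7 l₁ l₂ l₃ 3≤l₃ _ l₁[l₃∸1]+l₂>3 =
  S , S-increasing , θ⊆S , S⊆θ , S-twoRegular
  where
  l₁+l₂>0 : 1 ≤ l₁ + l₂
  l₁+l₂>0 = l₁[l₃∸1]+l₂>3⇒l₁+l₂>0 l₁ l₂ l₃ l₁[l₃∸1]+l₂>3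
  open Cantor l₁ l₂ l₃ 3≤l₃ l₁+l₂>0
  open Regularity l₁ l₂ l₃ 3≤l₃ l₁+l₂>0
  θ⊆S : ∀ m → inθ c m ≡ true → ∃ λ n → S n ≡ m
  θ⊆S m m∈θ = inA⇒S (trans (sym (inθ≡inA m)) m∈θ)
  S⊆θ : ∀ n → inθ c (S n) ≡ true
  S⊆θ n = trans (inθ≡inA (S n)) (inA-S n)
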